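{- Let $n\ge 2$, let $(W,S)$ be the Coxeter group of type $B_n$ with $S=\{s_1,\dots,s_n\}$, and let $I,J\subset S$. Then there is a natural bijection $$W_I\backslash W/W_J\;\xrightarrow{\ \sim\ }\;\mathrm{SCM}_n(\alpha_I,\alpha_J).$$
   Context: The Coxeter group of type $B_n$ has simple reflections $s_1,\dots,s_n$ with relations $s_i^2=1$, $(s_is_{i+1})^3=1$ for $1\le i\le n-2$, $(s_{n-1}s_n)^4=1$, $(s_is_j)^2=1$ for $|i-j|>1$; it is realized faithfully in $\mathrm{GL}_n(\mathbb{R})$ by sending $s_i$ ($i<n$) to the permutation matrix swapping coordinates $i,i+1$ and $s_n$ to $\mathrm{diag}(1,\dots,1,-1)$. $W_I$ is the parabolic subgroup generated by $I$. For $I\subset S$, the margin condition $\alpha_I=(\tilde\alpha,\lambda)$ is defined by: $\tilde\alpha=(\tilde\alpha_1,\dots,\tilde\alpha_k)$ is the unique composition of $n$ (decomposition of $\{1,\dots,n\}$ into consecutive nonempty intervals of sizes $\tilde\alpha_1,\dots,\tilde\alpha_k$) such that for $1\le i\le n-1$, $i$ and $i+1$ are in the same interval iff $s_i\in I$; and $\lambda=1$ if $s_n\in I$, $\lambda=0$ otherwise. Let $\mathbb{S}=\{(a^+,a^-):a^+,a^-\in\mathbb{Z}_{\ge0}\}$ (signed numbers) with $|a|=a^++a^-$. For margin conditions $\alpha=(\tilde\alpha,\lambda_\alpha)$, $\beta=(\tilde\beta,\lambda_\beta)$ with $\tilde\alpha$ of length $k$ and $\tilde\beta$ of length $l$, $\mathrm{SCM}_n(\alpha,\beta)$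 is the set of $k\times l$ matrices $A=(a_{ij})$ with entries $a_{ij}=(a_{ij}^+,a_{ij}^-)\in\mathbb{S}$ such that $\sum_j|a_{ij}|=\tilde\alpha_i$ for all $i$, $\sum_i|a_{ij}|=\tilde\beta_j$ for all $j$, and moreover $a^-_{k,j}=0$ for all $j$ if $\lambda_\alpha=1$, and $a^-_{i,l}=0$ for all $i$ if $\lambda_\beta=1$. -}

module Defs where

open import Data.Nat using (ℕ; zero; suc; _+_; _∸_; _≟_)
open import Data.Integer as ℤ using (ℤ; +_; -[1+_])
open import Data.Fin using (Fin; toℕ) renaming (zero to fzero; suc to fsuc)
open import Data.Fin.Subset using (Subset; _∈_)
open import Data.Bool using (Bool; true; false; if_then_else_)
open import Data.List using (List; []; _∷_; length; lookup; take; drop; foldr)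
open import Data.Bool.ListAction using (or)
open import Data.Vec using (toList)
open import Data.List.Relation.Unary.All using (All)
open import Data.Product using (Σ; _×_; _,_; proj₁; proj₂)
open import Relation.Nullary.Decidable using (⌊_⌋)
open import Relation.Binary.PropositionalEquality using (_≡_)

sumℕ : ∀ {k} → (Fin k → ℕ) → ℕ
sumℕ {zero}  f = 0
sumℕ {suc k} f = f fzero + sumℕ (λ i → f (fsuc i))

sumℤ : ∀ {k} → (Fin k → ℤ) → ℤ
sumℤ {zero}  f = + 0
sumℤ {suc k} f = f fzero ℤ.+ sumℤ (λ i → f (fsuc i))

Matrix : ℕ → Set
Matrix n = Fin n → Fin n → ℤ

_≈M_ : ∀ {n} → Matrix n → Matrix n → Set
A ≈M B = ∀ i j → A i j ≡ B i j

_·_ : ∀ {n} → Matrix n → Matrix n → Matrix n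
(A · B) i j = sumℤ (λ k → A i k ℤ.* B k j)

idM : ∀ {n} → Matrix n
idM i j = if ⌊ toℕ i ≟ toℕ j ⌋ then + 1 else + 0

swapℕ : ℕ → ℕ → ℕ
swapℕ x y = if ⌊ y ≟ x ⌋ then suc x
            else (if ⌊ y ≟ suc x ⌋ then x else y)

-- matrix of the simple reflection s_{k+1} (k : Fin n is 0-based):
-- for k+1 < n the permutation matrix swapping coordinates k, k+1;
-- for k+1 = n the matrix diag(1,…,1,-1).
gen : (n : ℕ) → Fin n → Matrix n
gen n k i j =
  if ⌊ suc (toℕ k) ≟ n ⌋
  then (if ⌊ toℕ i ≟ toℕ j ⌋
        then (if ⌊ toℕ i ≟ toℕ k ⌋ then -[1+ 0 ] else + 1)
        else + 0)
  else (if ⌊ swapℕ (toℕ k) (toℕ i) ≟ toℕ j ⌋ then + 1 else + 0)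

-- Elements of W(B_n): words in the simple reflections, realized
-- (faithfully) as matrices.

Word : ℕ → Set
Word n = List (Fin n)

mat : ∀ {n} → Word n → Matrix n
mat {n} = foldr (λ k M → gen n k · M) idM

InW : ∀ {n} → Subset n → Word n → Set
InW I u = All (λ k → k ∈ I) u

SameDoubleCoset : ∀ {n} → Subset n → Subset n → Word n → Word n → Set
SameDoubleCoset {n} I J w w' =
  Σ (Word n) λ u → Σ (Word n) λ v →
    InW I u × InW J v × (((mat u · mat w) · mat v) ≈M mat w')

record Margin : Set where
  constructor margin
  field
    comp : List ℕ
    lam  : Bool

-- blocks: bits b_1 … b_{n-1} (b_i = true iff s_i ∈ I) ↦ block sizes
compGo : ℕ → List Bool → List ℕ
compGo c []           = c ∷ []
compGo c (true ∷ bs)  = compGo (suc c) bs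
compGo c (false ∷ bs) = c ∷ compGo 1 bs

-- α_I ; index k : Fin n corresponds to s_{k+1}
marginOf : ∀ {n} → Subset n → Margin
marginOf {n} I =
  margin (compGo 1 (take (n ∸ 1) (toList I))) (or (drop (n ∸ 1) (toList I)))

∣_∣ₛ : ℕ × ℕ → ℕ
∣ a ∣ₛ = proj₁ a + proj₂ a

record SCM (α β : Margin) : Set where
  open Margin
  field
    entry   : Fin (length (comp α)) → Fin (length (comp β)) → ℕ × ℕ
    rowSum  : ∀ i → sumℕ (λ j → ∣ entry i j ∣ₛ) ≡ lookup (comp α) i
    colSum  : ∀ j → sumℕ (λ i → ∣ entry i j ∣ₛ) ≡ lookup (comp β) j
    lastRow : lam α ≡ true → ∀ i j → suc (toℕ i) ≡ length (comp α) →
              proj₂ (entry i j) ≡ 0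
    lastCol : lam β ≡ true → ∀ i j → suc (toℕ j) ≡ length (comp β) →
              proj₂ (entry i j) ≡ 0

_≈SCM_ : ∀ {α β} → SCM α β → SCM α β → Set
A ≈SCM B = ∀ i j → SCM.entry A i j ≡ SCM.entry B i j

{-# OPTIONS --safe #-}
module Submission where

-- A word is read as a signed permutation matrix: row r is ±e_σ(r).  Its matrix in SCM(α_I, α_J)
-- counts, for each block i of α_I and block j of α_J, the rows r in block i with σ(r) in block j,
-- split by sign, where signs in the last block of a margin with λ = 1 are counted as +.
-- Left multiplication by W_I permutes rows within I-blocks and negates rows in the last one
-- (when λ_I = 1); right multiplication by W_J does the same to columns; so the matrix only
-- depends on the double coset.  Conversely, two words with the same matrix are matched by
-- sorting the rows within I-blocks with adjacent transpositions, fixing the row signs that are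
-- not recorded, then sorting the columns within J-blocks and fixing the remaining column signs.
-- Every matrix arises: lay out each of its rows along the rows of the corresponding I-block,
-- then realise the column blocks by a permutation and the signs by sign changes.

open import Defs
open import Data.Nat using (ℕ; zero; suc; _+_; _*_; _∸_; _≤_; _<_; z≤n; s≤s; _≟_; _<?_; _⊓_)
open import Data.Nat.Properties
open import Algebra.Properties.CommutativeSemigroup +-commutativeSemigroup using (interchange)
open import Data.Integer as ℤ using (ℤ; -[1+_])
import Data.Integer.Properties as ℤP
open import Data.Fin using (Fin; toℕ; fromℕ<) renaming (zero to fzero; suc to fsuc)
open import Data.Fin.Properties using (toℕ<n; toℕ-fromℕ<; fromℕ<-toℕ)
open import Data.Fin.Subset using (Subset; _∈_)
open import Data.Bool using (Bool; true; false; if_then_else_; _xor_; _∧_; not)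
open import Data.Bool.Properties using (xor-assoc; not-distribˡ-xor; ∧-zeroʳ; ∨-identityʳ)
import Data.Bool.Properties as Bool
open import Data.Bool.ListAction using (or)
open import Data.Product using (Σ; _×_; _,_; proj₁; proj₂)
open import Data.Sum using (_⊎_; inj₁; inj₂)
open import Data.Empty using (⊥-elim)
open import Function using (_∘_)
open import Relation.Nullary using (yes; no; Dec)
open import Relation.Nullary.Decidable using (⌊_⌋)
open import Relation.Binary.PropositionalEquality hiding ([_])
open import Relation.Binary.Definitions using (DecidableEquality)
open import Data.List using (List; []; _∷_; _++_; reverse; [_]; length; take; drop; map; lookup)
open import Data.List.Properties using (length-take; reverse-involutive; unfold-reverse)
open import Data.List.Relation.Unary.All using (All; []; _∷_)
import Data.List.Relation.Unary.All as All
open import Data.List.Relation.Unary.All.Properties using (++⁺)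
open import Data.List.Relation.Binary.Permutation.Propositional using (↭-sym)
open import Data.List.Relation.Binary.Permutation.Propositional.Properties using (All-resp-↭; ↭-reverse)
open import Data.Vec using (toList; here; there) renaming (_∷_ to _∷v_)
open import Data.Vec.Properties using (length-toList)

∑< : ℕ → (ℕ → ℕ) → ℕ
∑< zero    f = 0
∑< (suc m) f = ∑< m f + f m

syntax ∑< m (λ r → e) = ∑[ r < m ] e

∑<-cong : ∀ m {f g : ℕ → ℕ} → (∀ r → r < m → f r ≡ g r) → ∑< m f ≡ ∑< m g
∑<-cong zero    f≡g = refl
∑<-cong (suc m) f≡g = cong₂ _+_ (∑<-cong m (λ r r<m → f≡g r (m<n⇒m<1+n r<m))) (f≡g m ≤-refl)

∑<-zero : ∀ m {f : ℕ → ℕ} → (∀ r → r < m → f r ≡ 0) → ∑< m f ≡ 0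
∑<-zero zero    f≡0 = refl
∑<-zero (suc m) f≡0 =
  cong₂ _+_ (∑<-zero m (λ r r<m → f≡0 r (m<n⇒m<1+n r<m))) (f≡0 m ≤-refl)

∑<-zero⇒ : ∀ m (f : ℕ → ℕ) → ∑< m f ≡ 0 → ∀ r → r < m → f r ≡ 0
∑<-zero⇒ (suc m) f sum≡0 r r<1+m with m≤n⇒m<n∨m≡n (m<1+n⇒m≤n r<1+m)
... | inj₁ r<m  = ∑<-zero⇒ m f (m+n≡0⇒m≡0 _ sum≡0) r r<m
... | inj₂ refl = m+n≡0⇒n≡0 (∑< r f) sum≡0

∑<-const : ∀ m c → ∑[ _ < m ] c ≡ m * c
∑<-const zero    c = refl
∑<-const (suc m) c = trans (cong (_+ c) (∑<-const m c)) (+-comm (m * c) c)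

∑<-unfoldˡ : ∀ m (g : ℕ → ℕ) → ∑< (suc m) g ≡ g 0 + ∑< m (g ∘ suc)
∑<-unfoldˡ zero    g = sym (+-identityʳ (g 0))
∑<-unfoldˡ (suc m) g = trans (cong (_+ g (suc m)) (∑<-unfoldˡ m g)) (+-assoc (g 0) _ _)

∑<-split : ∀ a b (g : ℕ → ℕ) → ∑< (a + b) g ≡ ∑< a g + ∑[ t < b ] g (a + t)
∑<-split a zero    g = trans (cong (λ x → ∑< x g) (+-identityʳ a)) (sym (+-identityʳ _))
∑<-split a (suc b) g = begin
  ∑< (a + suc b) g                                   ≡⟨ cong (λ x → ∑< x g) (+-suc a b) ⟩
  ∑< (a + b) g + g (a + b)                           ≡⟨ cong (_+ g (a + b)) (∑<-split a b g) ⟩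
  ∑< a g + ∑[ t < b ] g (a + t) + g (a + b)          ≡⟨ +-assoc (∑< a g) _ _ ⟩
  ∑< a g + ∑[ t < suc b ] g (a + t)                  ∎
  where open ≡-Reasoning

∑<-distrib-+ : ∀ m (f g : ℕ → ℕ) → ∑[ r < m ] (f r + g r) ≡ ∑< m f + ∑< m g
∑<-distrib-+ zero    f g = refl
∑<-distrib-+ (suc m) f g =
  trans (cong (_+ (f m + g m)) (∑<-distrib-+ m f g)) (interchange (∑< m f) (∑< m g) _ _)

∑<-distribˡ-* : ∀ m a (g : ℕ → ℕ) → ∑[ r < m ] (a * g r) ≡ a * ∑< m g
∑<-distribˡ-* zero    a g = sym (*-zeroʳ a)
∑<-distribˡ-* (suc m) a g =
  trans (cong (_+ a * g m) (∑<-distribˡ-* m a g)) (sym (*-distribˡ-+ a (∑< m g) (g m)))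

∑<-distribʳ-* : ∀ m a (g : ℕ → ℕ) → ∑[ r < m ] (g r * a) ≡ ∑< m g * a
∑<-distribʳ-* m a g =
  trans (∑<-cong m (λ r _ → *-comm (g r) a)) (trans (∑<-distribˡ-* m a g) (*-comm a _))

∑<-comm : ∀ m l (g : ℕ → ℕ → ℕ) → ∑[ r < m ] ∑[ j < l ] g r j ≡ ∑[ j < l ] ∑[ r < m ] g r j
∑<-comm zero    l g = sym (∑<-zero l (λ _ _ → refl))
∑<-comm (suc m) l g = trans (cong (_+ ∑< l (g m)) (∑<-comm m l g))
  (sym (∑<-distrib-+ l (λ j → ∑[ r < m ] g r j) (g m)))

sumℕ≡∑< : ∀ l (g : ℕ → ℕ) → sumℕ {l} (g ∘ toℕ) ≡ ∑< l g
sumℕ≡∑< zero    g = refl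
sumℕ≡∑< (suc l) g = trans (cong (g 0 +_) (sumℕ≡∑< l (g ∘ suc))) (sym (∑<-unfoldˡ l g))

sumℕ-cong : ∀ {l} {f g : Fin l → ℕ} → (∀ j → f j ≡ g j) → sumℕ f ≡ sumℕ g
sumℕ-cong {zero}  f≡g = refl
sumℕ-cong {suc l} f≡g = cong₂ _+_ (f≡g fzero) (sumℕ-cong (f≡g ∘ fsuc))

⟦_⟧ : Bool → ℕ
⟦ true  ⟧ = 1
⟦ false ⟧ = 0

_==_ : ℕ → ℕ → Bool
a == b = ⌊ a ≟ b ⌋

==-refl : ∀ a → (a == a) ≡ true
==-refl a with a ≟ a
... | yes _  = refl
... | no a≢a = ⊥-elim (a≢a refl)

==-≢ : ∀ {a b} → a ≢ b → (a == b) ≡ false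
==-≢ {a} {b} a≢b with a ≟ b
... | yes a≡b = ⊥-elim (a≢b a≡b)
... | no _    = refl

==⇒≡ : ∀ {a b} → (a == b) ≡ true → a ≡ b
==⇒≡ {a} {b} eq with a ≟ b
... | yes a≡b = a≡b

==-suc : ∀ a b → (suc a == suc b) ≡ (a == b)
==-suc a b with a ≟ b
... | yes refl = ==-refl (suc a)
... | no a≢b   = ==-≢ (a≢b ∘ suc-injective)

∑<-indicator : ∀ l c → c < l → ∑[ j < l ] ⟦ c == j ⟧ ≡ 1
∑<-indicator (suc l) c c<1+l with c ≟ l
... | yes refl = cong (_+ 1) (∑<-zero c (λ j j<c → cong ⟦_⟧ (==-≢ (>⇒≢ j<c))))
... | no c≢l   = trans (+-identityʳ _) (∑<-indicator l c (≤∧≢⇒< (m<1+n⇒m≤n c<1+l) c≢l))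

∑<-nonzero : ∀ m (f : ℕ → Bool) → ∑[ r < m ] ⟦ f r ⟧ ≢ 0 → Σ ℕ λ p → p < m × f p ≡ true
∑<-nonzero zero    f ≢0 = ⊥-elim (≢0 refl)
∑<-nonzero (suc m) f ≢0 with f m in fm
... | true  = m , ≤-refl , fm
... | false =
  let (p , p<m , fp) = ∑<-nonzero m f (≢0 ∘ trans (+-identityʳ _)) in p , m<n⇒m<1+n p<m , fp

-- Reindexing the positions r with P r by their rank among them.
∑<-rank : ∀ m (P : ℕ → Bool) (g : ℕ → ℕ) →
  ∑[ r < m ] (⟦ P r ⟧ * g (∑[ r' < r ] ⟦ P r' ⟧)) ≡ ∑< (∑[ r < m ] ⟦ P r ⟧) g
∑<-rank zero    P g = refl
∑<-rank (suc m) P g with P m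
... | true  = trans (cong₂ _+_ (∑<-rank m P g) (+-identityʳ _))
                    (cong (λ q → ∑< q g) (+-comm 1 _))
... | false = trans (+-identityʳ _) (trans (∑<-rank m P g)
                    (cong (λ q → ∑< q g) (sym (+-identityʳ (∑[ r < m ] ⟦ P r ⟧)))))

swapℕ-self : ∀ k → swapℕ k k ≡ suc k
swapℕ-self k rewrite ==-refl k = refl

swapℕ-suc : ∀ k → swapℕ k (suc k) ≡ k
swapℕ-suc k rewrite ==-≢ {suc k} {k} 1+n≢n | ==-refl (suc k) = refl

swapℕ-other : ∀ k y → y ≢ k → y ≢ suc k → swapℕ k y ≡ y
swapℕ-other k y y≢k y≢1+k rewrite ==-≢ y≢k | ==-≢ y≢1+k = refl

swapℕ-involutive : ∀ k y → swapℕ k (swapℕ k y) ≡ y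
swapℕ-involutive k y with y ≟ k
... | yes refl = swapℕ-suc k
... | no y≢k with y ≟ suc k
...   | yes refl  = swapℕ-self k
...   | no y≢1+k = swapℕ-other k y y≢k y≢1+k

swapℕ-< : ∀ k y m → suc k < m → y < m → swapℕ k y < m
swapℕ-< k y m 1+k<m y<m with y ≟ k
... | yes _ = 1+k<m
... | no _ with y ≟ suc k
...   | yes _ = <-trans (n<1+n k) 1+k<m
...   | no _  = y<m

swapℕ-fixes-above : ∀ k y → suc k < y → swapℕ k y ≡ y
swapℕ-fixes-above k y 1+k<y = swapℕ-other k y (>⇒≢ (<-trans (n<1+n k) 1+k<y)) (>⇒≢ 1+k<y)

swapℕ-fixes-below : ∀ k y → y < k → swapℕ k y ≡ y
swapℕ-fixes-below k y y<k = swapℕ-other k y (<⇒≢ y<k) (<⇒≢ (m<n⇒m<1+n y<k))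

∑<-swapℕ : ∀ k m (g : ℕ → ℕ) → suc k < m → ∑[ r < m ] g (swapℕ k r) ≡ ∑< m g
∑<-swapℕ k (suc m) g (s≤s 1+k≤m) with m≤n⇒m<n∨m≡n 1+k≤m
... | inj₁ 1+k<m = cong₂ _+_ (∑<-swapℕ k m g 1+k<m) (cong g (swapℕ-fixes-above k m 1+k<m))
... | inj₂ refl  = begin
  ∑[ r < k ] g (swapℕ k r) + g (swapℕ k k) + g (swapℕ k (suc k))
    ≡⟨ cong₂ (λ a b → a + g b + g (swapℕ k (suc k))) below (swapℕ-self k) ⟩
  ∑< k g + g (suc k) + g (swapℕ k (suc k))
    ≡⟨ cong (λ a → ∑< k g + g (suc k) + g a) (swapℕ-suc k) ⟩
  ∑< k g + g (suc k) + g k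
    ≡⟨ +-assoc (∑< k g) _ _ ⟩
  ∑< k g + (g (suc k) + g k)
    ≡⟨ cong (∑< k g +_) (+-comm (g (suc k)) (g k)) ⟩
  ∑< k g + (g k + g (suc k))
    ≡⟨ sym (+-assoc (∑< k g) _ _) ⟩
  ∑< k g + g k + g (suc k) ∎
  where
  open ≡-Reasoning
  below : ∑[ r < k ] g (swapℕ k r) ≡ ∑< k g
  below = ∑<-cong k (λ r r<k → cong g (swapℕ-fixes-below k r r<k))

-- Signed permutations

-- A signed permutation is encoded by its rows: r ↦ (σ r , ε r) says that row r of its matrix
-- has the entry (-1)^(ε r) in column σ r and zeros elsewhere.  Only the rows r < n matter.
Signed : Set
Signed = ℕ × Bool

SignedMap : Set
SignedMap = ℕ → Signed

negate : Signed → Signed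
negate (v , s) = v , not s

flipIf : Bool → Signed → Signed
flipIf c (v , s) = v , c xor s

-- Left multiplication by the generator s_{k+1}.
genAct : ℕ → ℕ → SignedMap → SignedMap
genAct n k X r = if suc k == n then (if r == k then negate (X r) else X r) else X (swapℕ k r)

genPerm : ℕ → ℕ → ℕ → ℕ
genPerm n k r = if suc k == n then r else swapℕ k r

perm : ℕ → List ℕ → ℕ → ℕ
perm n []      r = r
perm n (k ∷ u) r = perm n u (genPerm n k r)

actLeft : ℕ → List ℕ → SignedMap → SignedMap
actLeft n []      X = X
actLeft n (k ∷ u) X = genAct n k (actLeft n u X)

apply : SignedMap → Signed → Signed
apply Y (x , s) = proj₁ (Y x) , s xor proj₂ (Y x)

_⊙_ : SignedMap → SignedMap → SignedMap
(X ⊙ Y) r = apply Y (X r)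

idSigned : SignedMap
idSigned r = r , false

signed : ℕ → List ℕ → SignedMap
signed n u = actLeft n u idSigned

actRight : ℕ → List ℕ → SignedMap → SignedMap
actRight n v X = X ⊙ signed n v

genAct-cong : ∀ n k {X Y} → X ≗ Y → genAct n k X ≗ genAct n k Y
genAct-cong n k X≗Y r with suc k == n
... | false = X≗Y (swapℕ k r)
... | true with r == k
...   | true  = cong negate (X≗Y r)
...   | false = X≗Y r

actLeft-cong : ∀ n u {X Y} → X ≗ Y → actLeft n u X ≗ actLeft n u Y
actLeft-cong n []      X≗Y = X≗Y
actLeft-cong n (k ∷ u) X≗Y = genAct-cong n k (actLeft-cong n u X≗Y)

actLeft-++ : ∀ n a c X → actLeft n (a ++ c) X ≡ actLeft n a (actLeft n c X)
actLeft-++ n []      c X = refl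
actLeft-++ n (k ∷ a) c X = cong (genAct n k) (actLeft-++ n a c X)

perm-++ : ∀ n a c r → perm n (a ++ c) r ≡ perm n c (perm n a r)
perm-++ n []      c r = refl
perm-++ n (k ∷ a) c r = perm-++ n a c (genPerm n k r)

proj₁-genAct : ∀ n k X r → proj₁ (genAct n k X r) ≡ proj₁ (X (genPerm n k r))
proj₁-genAct n k X r with suc k == n
... | false = refl
... | true with r == k
...   | true  = refl
...   | false = refl

proj₁-actLeft : ∀ n u X r → proj₁ (actLeft n u X r) ≡ proj₁ (X (perm n u r))
proj₁-actLeft n []      X r = refl
proj₁-actLeft n (k ∷ u) X r =
  trans (proj₁-genAct n k (actLeft n u X) r) (proj₁-actLeft n u X (genPerm n k r))

actLeft-swaps : ∀ n u X r → All (λ k → suc k < n) u → actLeft n u X r ≡ X (perm n u r)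
actLeft-swaps n []      X r []             = refl
actLeft-swaps n (k ∷ u) X r (1+k<n ∷ 1+u<n) rewrite ==-≢ (<⇒≢ 1+k<n) =
  actLeft-swaps n u X (swapℕ k r) 1+u<n

apply-cong : ∀ Y Z e → Y (proj₁ e) ≡ Z (proj₁ e) → apply Y e ≡ apply Z e
apply-cong Y Z (x , s) Yx≡Zx rewrite Yx≡Zx = refl

apply-⊙ : ∀ Y Z e → apply (Y ⊙ Z) e ≡ apply Z (apply Y e)
apply-⊙ Y Z (x , s) = cong (proj₁ (Z (proj₁ (Y x))) ,_) (sym (xor-assoc s (proj₂ (Y x)) _))

genAct-⊙ : ∀ n k Y Z → genAct n k (Y ⊙ Z) ≗ (genAct n k Y ⊙ Z)
genAct-⊙ n k Y Z x with suc k == n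
... | false = refl
... | true with x == k
...   | true  = cong (proj₁ (Z (proj₁ (Y x))) ,_) (not-distribˡ-xor (proj₂ (Y x)) _)
...   | false = refl

actLeft-⊙ : ∀ n u Y Z → actLeft n u (Y ⊙ Z) ≗ (actLeft n u Y ⊙ Z)
actLeft-⊙ n []      Y Z x = refl
actLeft-⊙ n (k ∷ u) Y Z x =
  trans (genAct-cong n k (actLeft-⊙ n u Y Z) x) (genAct-⊙ n k (actLeft n u Y) Z x)

actLeft≗signed-⊙ : ∀ n u X → actLeft n u X ≗ (signed n u ⊙ X)
actLeft≗signed-⊙ n u X = actLeft-⊙ n u idSigned X

actRight-++ : ∀ n a c X → actRight n (a ++ c) X ≗ actRight n c (actRight n a X)
actRight-++ n a c X r = begin
  apply (signed n (a ++ c)) (X r)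
    ≡⟨ apply-cong (signed n (a ++ c)) (actLeft n a (signed n c)) (X r) (cong (λ F → F (proj₁ (X r))) (actLeft-++ n a c idSigned)) ⟩
  apply (actLeft n a (signed n c)) (X r)
    ≡⟨ apply-cong (actLeft n a (signed n c)) (signed n a ⊙ signed n c) (X r) (actLeft≗signed-⊙ n a (signed n c) (proj₁ (X r))) ⟩
  apply (signed n a ⊙ signed n c) (X r)
    ≡⟨ apply-⊙ (signed n a) (signed n c) (X r) ⟩
  apply (signed n c) (apply (signed n a) (X r)) ∎
  where open ≡-Reasoning

genPerm-involutive : ∀ n k r → genPerm n k (genPerm n k r) ≡ r
genPerm-involutive n k r with suc k == n
... | true  = refl
... | false = swapℕ-involutive k r

perm-reverseˡ : ∀ n u r → perm n (reverse u) (perm n u r) ≡ r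
perm-reverseˡ n []      r = refl
perm-reverseˡ n (k ∷ u) r
  rewrite unfold-reverse k u
        | perm-++ n (reverse u) [ k ] (perm n u (genPerm n k r))
        | perm-reverseˡ n u (genPerm n k r) = genPerm-involutive n k r

perm-reverseʳ : ∀ n u r → perm n u (perm n (reverse u) r) ≡ r
perm-reverseʳ n u r = subst (λ w → perm n w (perm n (reverse u) r) ≡ r)
  (reverse-involutive u) (perm-reverseˡ n (reverse u) r)

genPerm-< : ∀ n k r → k < n → r < n → genPerm n k r < n
genPerm-< n k r k<n r<n with suc k ≟ n
... | yes _   = r<n
... | no 1+k≢n = swapℕ-< k r n (≤∧≢⇒< k<n 1+k≢n) r<n

perm-< : ∀ n u r → All (_< n) u → r < n → perm n u r < n
perm-< n []      r []           r<n = r<n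
perm-< n (k ∷ u) r (k<n ∷ u<n) r<n = perm-< n u (genPerm n k r) u<n (genPerm-< n k r k<n r<n)

genPerm-fixes-above : ∀ n k x → suc k < x → genPerm n k x ≡ x
genPerm-fixes-above n k x 1+k<x with suc k == n
... | true  = refl
... | false = swapℕ-fixes-above k x 1+k<x

perm-fixes-above : ∀ n u x → All (λ k → suc k < x) u → perm n u x ≡ x
perm-fixes-above n []      x []           = refl
perm-fixes-above n (k ∷ u) x (1+k<x ∷ 1+u<x)
  rewrite genPerm-fixes-above n k x 1+k<x = perm-fixes-above n u x 1+u<x

-- Letters k with k + 1 = n act by a sign change only, which leaves the row order alone.
∑<-perm : ∀ n u m (g : ℕ → ℕ) → All (λ k → suc k < m ⊎ suc k ≡ n) u →
  ∑[ r < m ] g (perm n u r) ≡ ∑< m g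
∑<-perm n []      m g []        = refl
∑<-perm n (k ∷ u) m g (ok ∷ oks) =
  trans (∑<-genPerm ok) (∑<-perm n u m g oks)
  where
  ∑<-genPerm : suc k < m ⊎ suc k ≡ n →
    ∑[ r < m ] g (perm n u (genPerm n k r)) ≡ ∑[ r < m ] g (perm n u r)
  ∑<-genPerm ok with suc k ≟ n | ok
  ... | yes _    | _          = refl
  ... | no 1+k≢n | inj₂ 1+k≡n = ⊥-elim (1+k≢n 1+k≡n)
  ... | no _     | inj₁ 1+k<m = ∑<-swapℕ k m (g ∘ perm n u) 1+k<m

∑<-perm-< : ∀ n u (g : ℕ → ℕ) → All (_< n) u → ∑[ r < n ] g (perm n u r) ≡ ∑< n g
∑<-perm-< n u g u<n = ∑<-perm n u n g (All.map m≤n⇒m<n∨m≡n u<n)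

sign : Bool → ℤ
sign true  = -[1+ 0 ]
sign false = ℤ.+ 1

sign-xor : ∀ s t → sign s ℤ.* sign t ≡ sign (s xor t)
sign-xor true  true  = refl
sign-xor true  false = refl
sign-xor false true  = refl
sign-xor false false = refl

sign-injective : ∀ s t → sign s ≡ sign t → s ≡ t
sign-injective true  true  _ = refl
sign-injective false false _ = refl

rowEntry : ∀ {n} → Signed → Fin n → ℤ
rowEntry (v , s) j = if v == toℕ j then sign s else ℤ.+ 0

permMatrix : ∀ {n} → SignedMap → Matrix n
permMatrix X i j = rowEntry (X (toℕ i)) j

rowEntry-negate : ∀ {n} e (j : Fin n) → rowEntry (negate e) j ≡ -[1+ 0 ] ℤ.* rowEntry e j
rowEntry-negate (v , s) j with v == toℕ j
rowEntry-negate (v , true)  j | true  = refl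
rowEntry-negate (v , false) j | true  = refl
...                               | false = refl

rowEntry-injective : ∀ {n} (e e' : Signed) (j : Fin n) → proj₁ e ≡ toℕ j →
  rowEntry e j ≡ rowEntry e' j → e ≡ e'
rowEntry-injective (v , s) (v' , s') j refl eq rewrite ==-refl (toℕ j) with v' ≟ toℕ j
rowEntry-injective (v , s) (v' , s') j refl eq | yes refl = cong (v' ,_) (sign-injective s s' eq)
rowEntry-injective (v , true)  (v' , s') j refl () | no _
rowEntry-injective (v , false) (v' , s') j refl () | no _

sumℤ-cong : ∀ {k} {f g : Fin k → ℤ} → (∀ i → f i ≡ g i) → sumℤ f ≡ sumℤ g
sumℤ-cong {zero}  f≡g = refl
sumℤ-cong {suc k} f≡g = cong₂ ℤ._+_ (f≡g fzero) (sumℤ-cong (f≡g ∘ fsuc))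

sumℤ-zero : ∀ {k} {f : Fin k → ℤ} → (∀ i → f i ≡ ℤ.+ 0) → sumℤ f ≡ ℤ.+ 0
sumℤ-zero {zero}  f≡0 = refl
sumℤ-zero {suc k} f≡0 rewrite f≡0 fzero | sumℤ-zero {k} (f≡0 ∘ fsuc) = refl

sumℤ-single : ∀ n t (a : ℤ) (h : ℕ → ℤ) → t < n →
  sumℤ {n} (λ m → (if t == toℕ m then a else ℤ.+ 0) ℤ.* h (toℕ m)) ≡ a ℤ.* h t
sumℤ-single (suc n) zero    a h _ =
  trans (cong (ℤ._+_ (a ℤ.* h 0)) (sumℤ-zero {n} (λ _ → refl))) (ℤP.+-identityʳ _)
sumℤ-single (suc n) (suc t) a h (s≤s t<n) = trans (ℤP.+-identityˡ _)
  (trans (sumℤ-cong {n} (λ m → cong (λ c → (if c then a else ℤ.+ 0) ℤ.* h (suc (toℕ m))) (==-suc t (toℕ m))))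
         (sumℤ-single n t a (h ∘ suc) t<n))

·-cong : ∀ {n} {A A' B B' : Matrix n} → A ≈M A' → B ≈M B' → (A · B) ≈M (A' · B')
·-cong A≈A' B≈B' i j = sumℤ-cong (λ k → cong₂ ℤ._*_ (A≈A' i k) (B≈B' k j))

≈M-trans : ∀ {n} {A B C : Matrix n} → A ≈M B → B ≈M C → A ≈M C
≈M-trans A≈B B≈C i j = trans (A≈B i j) (B≈C i j)

≈M-sym : ∀ {n} {A B : Matrix n} → A ≈M B → B ≈M A
≈M-sym A≈B i j = sym (A≈B i j)

permMatrix-cong : ∀ {n} {X Y : SignedMap} → (∀ r → r < n → X r ≡ Y r) → permMatrix {n} X ≈M permMatrix Y
permMatrix-cong X≡Y i j = cong (λ e → rowEntry e j) (X≡Y (toℕ i) (toℕ<n i))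

gen·permMatrix : ∀ n (k : Fin n) X → (gen n k · permMatrix X) ≈M permMatrix (genAct n (toℕ k) X)
gen·permMatrix n k X i j with suc (toℕ k) ≟ n
... | yes _ = trans (sumℤ-single n (toℕ i) _ (λ x → rowEntry (X x) j) (toℕ<n i)) (negated (toℕ i ≟ toℕ k))
  where
  negated : ∀ d → (if ⌊ d ⌋ then -[1+ 0 ] else ℤ.+ 1) ℤ.* rowEntry (X (toℕ i)) j ≡
                  rowEntry (if ⌊ d ⌋ then negate (X (toℕ i)) else X (toℕ i)) j
  negated (yes _) = sym (rowEntry-negate (X (toℕ i)) j)
  negated (no _)  = ℤP.*-identityˡ _
... | no 1+k≢n = trans (sumℤ-single n (swapℕ (toℕ k) (toℕ i)) (ℤ.+ 1) (λ x → rowEntry (X x) j)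
                         (swapℕ-< (toℕ k) (toℕ i) n (≤∧≢⇒< (toℕ<n k) 1+k≢n) (toℕ<n i)))
                       (ℤP.*-identityˡ _)

letters : ∀ {n} → Word n → List ℕ
letters = map toℕ

letters-< : ∀ {m} (u : Word m) → All (_< m) (letters u)
letters-< []      = []
letters-< (k ∷ u) = toℕ<n k ∷ letters-< u

mat≈permMatrix : ∀ n (w : Word n) → mat w ≈M permMatrix (signed n (letters w))
mat≈permMatrix n []      i j = refl
mat≈permMatrix n (k ∷ w) i j =
  trans (·-cong {n} {gen n k} (λ _ _ → refl) (mat≈permMatrix n w) i j)
        (gen·permMatrix n k (signed n (letters w)) i j)

permMatrix-⊙ : ∀ n (X Y : SignedMap) → (∀ r → r < n → proj₁ (X r) < n) →
  (permMatrix {n} X · permMatrix Y) ≈M permMatrix (X ⊙ Y)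
permMatrix-⊙ n X Y X<n i j with X (toℕ i) | X<n (toℕ i) (toℕ<n i)
... | v , s | v<n = trans (sumℤ-single n v (sign s) (λ x → rowEntry (Y x) j) v<n) (sign-rowEntry (proj₁ (Y v)) (proj₂ (Y v)))
  where
  sign-rowEntry : ∀ a t → sign s ℤ.* rowEntry (a , t) j ≡ rowEntry (a , s xor t) j
  sign-rowEntry a t with a == toℕ j
  ... | true  = sign-xor s t
  ... | false = ℤP.*-zeroʳ (sign s)

permMatrix-injective : ∀ n (X Y : SignedMap) → permMatrix {n} X ≈M permMatrix Y →
  (∀ r → r < n → proj₁ (X r) < n) → ∀ r → r < n → X r ≡ Y r
permMatrix-injective n X Y X≈Y X<n r r<n = subst (λ q → X q ≡ Y q) (toℕ-fromℕ< r<n)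
  (rowEntry-injective (X (toℕ i)) (Y (toℕ i)) j
    (trans (cong (proj₁ ∘ X) (toℕ-fromℕ< r<n)) (sym (toℕ-fromℕ< v<n))) (X≈Y i j))
  where
  i : Fin n
  i = fromℕ< r<n
  v<n : proj₁ (X r) < n
  v<n = X<n r r<n
  j : Fin n
  j = fromℕ< v<n

-- Blocks and sorting within blocks

-- Bits b k = true mean that s_{k+1} is in the parabolic subset, i.e. that k and k + 1 lie in
-- the same block of the composition; block b r is the 0-based index of the block of r.
block : (ℕ → Bool) → ℕ → ℕ
block b r = ∑[ k < r ] ⟦ not (b k) ⟧

Letter : ℕ → (ℕ → Bool) → ℕ → Set
Letter n b k = k < n × b k ≡ true

block-mono : ∀ b {r m} → r ≤ m → block b r ≤ block b m
block-mono b {r} {zero}  z≤n = ≤-refl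
block-mono b {r} {suc m} r≤1+m with m≤n⇒m<n∨m≡n r≤1+m
... | inj₂ refl       = ≤-refl
... | inj₁ (s≤s r≤m) = ≤-trans (block-mono b r≤m) (m≤m+n (block b m) _)

block-suc : ∀ b k → b k ≡ true → block b (suc k) ≡ block b k
block-suc b k bk rewrite bk = +-identityʳ _

block-suc⇒joined : ∀ b k → block b k ≡ block b (suc k) → b k ≡ true
block-suc⇒joined b k eq with b k
... | true  = refl
... | false = ⊥-elim (1+n≰n (≤-reflexive (sym (trans eq (+-comm (block b k) 1)))))

sameBlock⇒joined : ∀ b {r k m} → block b r ≡ block b m → r ≤ k → k < m → b k ≡ true
sameBlock⇒joined b {r} {k} {m} eq r≤k k<m = block-suc⇒joined b k (≤-antisym (block-mono b (n≤1+n k))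
  (≤-trans (block-mono b k<m) (≤-trans (≤-reflexive (sym eq)) (block-mono b r≤k))))

block-swapℕ : ∀ b k y → b k ≡ true → block b (swapℕ k y) ≡ block b y
block-swapℕ b k y bk with y ≟ k
... | yes refl = block-suc b k bk
... | no _ with y ≟ suc k
...   | yes refl = sym (block-suc b k bk)
...   | no _     = refl

block-genPerm : ∀ n b k y → b k ≡ true → block b (genPerm n k y) ≡ block b y
block-genPerm n b k y bk with suc k == n
... | true  = refl
... | false = block-swapℕ b k y bk

block-perm : ∀ n b u y → All (λ k → b k ≡ true) u → block b (perm n u y) ≡ block b y
block-perm n b []      y []        = refl
block-perm n b (k ∷ u) y (bk ∷ ls) =
  trans (block-perm n b u (genPerm n k y) ls) (block-genPerm n b k y bk)

bubbleDown : ℕ → ℕ → List ℕ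
bubbleDown p zero    = []
bubbleDown p (suc d) = p + d ∷ bubbleDown p d

bubbleDown-letters : ∀ p d → All (λ k → p ≤ k × k < p + d) (bubbleDown p d)
bubbleDown-letters p zero    = []
bubbleDown-letters p (suc d) = (m≤m+n p d , +-monoʳ-< p (n<1+n d)) ∷
  All.map (λ (p≤k , k<p+d) → p≤k , <-trans k<p+d (+-monoʳ-< p (n<1+n d))) (bubbleDown-letters p d)

perm-bubbleDown : ∀ n p d → p + d < n → perm n (bubbleDown p d) (p + d) ≡ p
perm-bubbleDown n p zero    _     = +-identityʳ p
perm-bubbleDown n p (suc d) p+d<n rewrite ==-≢ (<⇒≢ (subst (_< n) (+-suc p d) p+d<n))
                                        | +-suc p d | swapℕ-suc (p + d) =
  perm-bubbleDown n p d (<-trans (n<1+n _) p+d<n)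

ℕ×-≟ : {C : Set} → DecidableEquality C → DecidableEquality (ℕ × C)
ℕ×-≟ _≟C_ (a , x) (b , y) with a ≟ b | x ≟C y
... | yes refl | yes refl = yes refl
... | no a≢b   | _        = no (a≢b ∘ cong proj₁)
... | yes _    | no x≢y   = no (x≢y ∘ cong proj₂)

⟦ℕ×-≟⟧ : {C : Set} (_≟C_ : DecidableEquality C) → ∀ a x b y →
  ⟦ ⌊ ℕ×-≟ _≟C_ (a , x) (b , y) ⌋ ⟧ ≡ ⟦ a == b ⟧ * ⟦ ⌊ x ≟C y ⌋ ⟧
⟦ℕ×-≟⟧ _≟C_ a x b y with a ≟ b | x ≟C y
... | yes refl | yes refl = refl
... | no _     | _        = refl
... | yes refl | no _     = refl

count : {C : Set} → DecidableEquality C → ℕ → (ℕ → C) → C → ℕ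
count _≟C_ m c x = ∑[ r < m ] ⟦ ⌊ c r ≟C x ⌋ ⟧

module Sorting {C : Set} (_≟C_ : DecidableEquality C) (n : ℕ) (b : ℕ → Bool) where

  private
    _≟K_ : DecidableEquality (ℕ × C)
    _≟K_ = ℕ×-≟ _≟C_

    keyed : (ℕ → C) → ℕ → ℕ × C
    keyed c r = block b r , c r

  SameBlockContent : ℕ → (ℕ → C) → (ℕ → C) → Set
  SameBlockContent m c t = ∀ x → count _≟K_ m (keyed c) x ≡ count _≟K_ m (keyed t) x

  InBlockSwap : ℕ → ℕ → Set
  InBlockSwap m k = suc k < m × b k ≡ true

  SortsTo : ℕ → (ℕ → C) → (ℕ → C) → Set
  SortsTo m c t = Σ (List ℕ) λ u → All (InBlockSwap m) u × (∀ r → r < m → c (perm n u r) ≡ t r)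

  count-perm : ∀ m u c x → All (InBlockSwap m) u →
    count _≟K_ m (keyed (c ∘ perm n u)) x ≡ count _≟K_ m (keyed c) x
  count-perm m u c x swaps = trans
    (∑<-cong m (λ r _ → cong (λ β → ⟦ ⌊ (β , c (perm n u r)) ≟K x ⌋ ⟧)
                             (sym (block-perm n b u r (All.map proj₂ swaps)))))
    (∑<-perm n u m (λ r → ⟦ ⌊ keyed c r ≟K x ⌋ ⟧) (All.map (inj₁ ∘ proj₁) swaps))

  sameBlockContent-init : ∀ m c t → SameBlockContent (suc m) c t → c m ≡ t m → SameBlockContent m c t
  sameBlockContent-init m c t same cm≡tm x = +-cancelʳ-≡ _ _ _
    (trans (same x) (cong (λ y → count _≟K_ m (keyed t) x + ⟦ ⌊ (block b m , y) ≟K x ⌋ ⟧) (sym cm≡tm)))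

  keyOccurs : ∀ m c t → SameBlockContent (suc m) c t → Σ ℕ λ p → p ≤ m × keyed c p ≡ keyed t m
  keyOccurs m c t same with ∑<-nonzero (suc m) (λ r → ⌊ keyed c r ≟K keyed t m ⌋) present
    where
    present : count _≟K_ (suc m) (keyed c) (keyed t m) ≢ 0
    present eq with keyed t m ≟K keyed t m | same (keyed t m)
    ... | yes _  | same-tm = 1+n≢0 (trans (sym (+-comm _ 1)) (trans (sym same-tm) eq))
    ... | no t≢t | _       = t≢t refl
  ... | p , p<1+m , found with keyed c p ≟K keyed t m
  ...   | yes keys≡ = p , m<1+n⇒m≤n p<1+m , keys≡

  InBlockSwap⇒Letter : ∀ {m k} → InBlockSwap m k → Letter m b k
  InBlockSwap⇒Letter (1+k<m , bk) = <-trans (n<1+n _) 1+k<m , bk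

  -- The position p carrying the key of t at m is bubbled up to m (within its block),
  -- and [0, m) is sorted recursively.
  sortWithinBlocks : ∀ m → m ≤ n → ∀ c t → SameBlockContent m c t → SortsTo m c t
  sortWithinBlocks zero    _     c t _    = [] , [] , λ _ ()
  sortWithinBlocks (suc m) 1+m≤n c t same with keyOccurs m c t same
  ... | p , p≤m , keys≡ = sortUp (sortWithinBlocks m (<⇒≤ 1+m≤n) (c ∘ perm n down) t
          (sameBlockContent-init m (c ∘ perm n down) t
            (λ x → trans (count-perm (suc m) down c x downSwaps) (same x)) down-m))
    where
    d : ℕ
    d = m ∸ p
    p+d≡m : p + d ≡ m
    p+d≡m = m+[n∸m]≡n p≤m
    down : List ℕ
    down = bubbleDown p d
    downSwaps : All (InBlockSwap (suc m)) down
    downSwaps = All.map (λ {k} (p≤k , k<p+d) → let k<m = subst (k <_) p+d≡m k<p+d in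
                  s≤s k<m , sameBlock⇒joined b (cong proj₁ keys≡) p≤k k<m) (bubbleDown-letters p d)
    down-m : c (perm n down m) ≡ t m
    down-m = trans (cong (c ∘ perm n down) (sym p+d≡m))
      (trans (cong c (perm-bubbleDown n p d (subst (_< n) (sym p+d≡m) 1+m≤n))) (cong proj₂ keys≡))
    sortUp : SortsTo m (c ∘ perm n down) t → SortsTo (suc m) c t
    sortUp (u , swaps , sorted) =
      u ++ down , ++⁺ (All.map (λ (1+k<m , bk) → m<n⇒m<1+n 1+k<m , bk) swaps) downSwaps , sorted-all
      where
      sorted-all : ∀ r → r < suc m → c (perm n (u ++ down) r) ≡ t r
      sorted-all r r<1+m rewrite perm-++ n u down r with m≤n⇒m<n∨m≡n (m<1+n⇒m≤n r<1+m)
      ... | inj₁ r<m = sorted r r<m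
      ... | inj₂ refl rewrite perm-fixes-above n u r (All.map proj₁ swaps) = down-m

All-reverse : ∀ {P : ℕ → Set} u → All P u → All P (reverse u)
All-reverse u = All-resp-↭ (↭-sym (↭-reverse u))

flipIf-flipIf : ∀ a c e → flipIf a (flipIf c e) ≡ flipIf (a xor c) e
flipIf-flipIf a c (v , s) = cong (v ,_) (sym (xor-assoc a c s))

-- The conjugate of s_n by a bubble word moving n - 1 down to r: it negates row r.
flipWord : ℕ → ℕ → List ℕ
flipWord n' r = reverse (bubbleDown r (n' ∸ r)) ++ n' ∷ bubbleDown r (n' ∸ r)

actLeft-flipWord : ∀ n' r X x → r ≤ n' → actLeft (suc n') (flipWord n' r) X x ≡ flipIf (x == r) (X x)
actLeft-flipWord n' r X x r≤n' = begin
  actLeft n (reverse down ++ n' ∷ down) X x    ≡⟨ cong (λ F → F x) (actLeft-++ n (reverse down) (n' ∷ down) X) ⟩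
  actLeft n (reverse down) Z x                 ≡⟨ actLeft-swaps n (reverse down) Z x (All-reverse down downSwaps) ⟩
  Z (perm n (reverse down) x)                  ≡⟨ Z-flips (perm n (reverse down) x) ⟩
  flipIf (perm n (reverse down) x == n') (X (perm n down (perm n (reverse down) x)))
                                               ≡⟨ cong₂ flipIf (lands-on-n' x) (cong X (perm-reverseʳ n down x)) ⟩
  flipIf (x == r) (X x)                        ∎
  where
  open ≡-Reasoning
  n d : ℕ
  n = suc n'
  d = n' ∸ r
  down : List ℕ
  down = bubbleDown r d
  r+d≡n' : r + d ≡ n'
  r+d≡n' = m+[n∸m]≡n r≤n'
  downSwaps : All (λ k → suc k < n) down
  downSwaps = All.map (λ {k} (_ , k<r+d) → s≤s (subst (k <_) r+d≡n' k<r+d)) (bubbleDown-letters r d)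
  Z : SignedMap
  Z = genAct n n' (actLeft n down X)
  Z-flips : ∀ y → Z y ≡ flipIf (y == n') (X (perm n down y))
  Z-flips y rewrite ==-refl n with y == n'
  ... | true  = cong negate (actLeft-swaps n down X y downSwaps)
  ... | false = actLeft-swaps n down X y downSwaps
  down-n' : perm n down n' ≡ r
  down-n' = trans (cong (perm n down) (sym r+d≡n')) (perm-bubbleDown n r d (subst (_< n) (sym r+d≡n') ≤-refl))
  lands-on-n' : ∀ x → (perm n (reverse down) x == n') ≡ (x == r)
  lands-on-n' x with perm n (reverse down) x ≟ n' | x ≟ r
  ... | yes _  | yes _   = refl
  ... | no _   | no _    = refl
  ... | yes eq | no x≢r  = ⊥-elim (x≢r (trans (sym (perm-reverseʳ n down x)) (trans (cong (perm n down) eq) down-n')))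
  ... | no ≢n' | yes refl = ⊥-elim (≢n' (trans (cong (perm n (reverse down)) (sym down-n')) (perm-reverseˡ n down n')))

flipWord-letters : ∀ n' b r → r ≤ n' → b n' ≡ true → block b r ≡ block b n' →
  All (Letter (suc n') b) (flipWord n' r)
flipWord-letters n' b r r≤n' bn' sameBlock =
  ++⁺ (All-reverse (bubbleDown r d) downLetters) ((≤-refl , bn') ∷ downLetters)
  where
  d : ℕ
  d = n' ∸ r
  r+d≡n' : r + d ≡ n'
  r+d≡n' = m+[n∸m]≡n r≤n'
  downLetters : All (Letter (suc n') b) (bubbleDown r d)
  downLetters = All.map (λ {k} (r≤k , k<r+d) → let k<n' = subst (k <_) r+d≡n' k<r+d in
    m<n⇒m<1+n k<n' , sameBlock⇒joined b sameBlock r≤k k<n') (bubbleDown-letters r d)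

flipBelow : ℕ → (ℕ → Bool) → ℕ → Bool
flipBelow m Q x = if ⌊ x <? m ⌋ then Q x else false

flipBelow-< : ∀ Q m x → x < m → flipBelow m Q x ≡ Q x
flipBelow-< Q m x x<m with x <? m
... | yes _   = refl
... | no x≮m = ⊥-elim (x≮m x<m)

flipBelow-suc : ∀ Q m x → flipBelow (suc m) Q x ≡ ((x == m) ∧ Q m) xor flipBelow m Q x
flipBelow-suc Q m x with x <? m | x ≟ m
... | yes x<m | yes refl = ⊥-elim (<-irrefl refl x<m)
... | yes x<m | no _     rewrite flipBelow-< Q (suc m) x (m<n⇒m<1+n x<m) = refl
... | no _    | yes refl rewrite flipBelow-< Q (suc x) x ≤-refl = sym (Bool.xor-identityʳ (Q x))
... | no x≮m  | no x≢m with x <? suc m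
...   | yes x<1+m = ⊥-elim (x≮m (≤∧≢⇒< (m<1+n⇒m≤n x<1+m) x≢m))
...   | no _      = refl

flipBelow-suc-false : ∀ Q m x → Q m ≡ false → flipBelow (suc m) Q x ≡ flipBelow m Q x
flipBelow-suc-false Q m x Qm rewrite flipBelow-suc Q m x | Qm | ∧-zeroʳ (x == m) = refl

flipBelow-suc-true : ∀ Q m x → Q m ≡ true → flipBelow (suc m) Q x ≡ (x == m) xor flipBelow m Q x
flipBelow-suc-true Q m x Qm rewrite flipBelow-suc Q m x | Qm | Bool.∧-identityʳ (x == m) = refl

flipSigns : ∀ n' b (Q : ℕ → Bool) → (∀ r → r ≤ n' → Q r ≡ true → b n' ≡ true × block b r ≡ block b n') →
  ∀ X m → m ≤ suc n' →
  Σ (List ℕ) λ u → All (Letter (suc n') b) u × (∀ x → actLeft (suc n') u X x ≡ flipIf (flipBelow m Q x) (X x))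
flipSigns n' b Q lastBlock X zero    _     = [] , [] , λ _ → refl
flipSigns n' b Q lastBlock X (suc m) 1+m≤n with flipSigns n' b Q lastBlock X m (<⇒≤ 1+m≤n) | Q m in Qm
... | u , letters , flipped | false = u , letters , λ x →
  trans (flipped x) (cong (λ c → flipIf c (X x)) (sym (flipBelow-suc-false Q m x Qm)))
... | u , letters , flipped | true = flipWord n' m ++ u ,
  ++⁺ (flipWord-letters n' b m m≤n' bn' sameBlock) letters , λ x → begin
    actLeft (suc n') (flipWord n' m ++ u) X x
      ≡⟨ cong (λ F → F x) (actLeft-++ (suc n') (flipWord n' m) u X) ⟩
    actLeft (suc n') (flipWord n' m) (actLeft (suc n') u X) x
      ≡⟨ actLeft-flipWord n' m (actLeft (suc n') u X) x m≤n' ⟩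
    flipIf (x == m) (actLeft (suc n') u X x)
      ≡⟨ cong (flipIf (x == m)) (flipped x) ⟩
    flipIf (x == m) (flipIf (flipBelow m Q x) (X x))
      ≡⟨ flipIf-flipIf (x == m) (flipBelow m Q x) (X x) ⟩
    flipIf ((x == m) xor flipBelow m Q x) (X x)
      ≡⟨ cong (λ c → flipIf c (X x)) (sym (flipBelow-suc-true Q m x Qm)) ⟩
    flipIf (flipBelow (suc m) Q x) (X x) ∎
  where
  open ≡-Reasoning
  m≤n' : m ≤ n'
  m≤n' = m<1+n⇒m≤n 1+m≤n
  bn' : b n' ≡ true
  bn' = proj₁ (lastBlock m m≤n' Qm)
  sameBlock : block b m ≡ block b n'
  sameBlock = proj₂ (lastBlock m m≤n' Qm)

xor-not-≟ : ∀ s t → s xor not ⌊ s Bool.≟ t ⌋ ≡ t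
xor-not-≟ true  true  = refl
xor-not-≟ true  false = refl
xor-not-≟ false true  = refl
xor-not-≟ false false = refl

fixedSign : ∀ s s' h cv → s ∧ (not h ∧ cv) ≡ s' ∧ (not h ∧ cv) →
  (h ∧ not ⌊ s Bool.≟ s' ⌋) xor s ≡ s' ⊎ cv ≡ false
fixedSign true  true  h     cv _  = inj₁ (cong (_xor true) (∧-zeroʳ h))
fixedSign false false h     cv _  = inj₁ (cong (_xor false) (∧-zeroʳ h))
fixedSign true  false true  cv _  = inj₁ refl
fixedSign false true  true  cv _  = inj₁ refl
fixedSign true  false false cv eq = inj₂ eq
fixedSign false true  false cv eq = inj₂ (sym eq)

module ColumnMatching (n' : ℕ) (b : ℕ → Bool) where

  private
    n : ℕ
    n = suc n'

  open Sorting _≟_ n b using (InBlockSwap; InBlockSwap⇒Letter; SameBlockContent; SortsTo; sortWithinBlocks)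

  inverseContent : ∀ U V → All (_< n) U → All (_< n) V →
    (∀ r → r < n → block b (perm n U r) ≡ block b (perm n V r)) →
    SameBlockContent n (perm n (reverse V)) (perm n (reverse U))
  inverseContent U V U<n V<n sameBlocks x = begin
      ∑[ y < n ] ⟦ ⌊ (block b y , perm n (reverse V) y) ≟K x ⌋ ⟧
        ≡⟨ sym (∑<-perm-< n V (λ y → ⟦ ⌊ (block b y , perm n (reverse V) y) ≟K x ⌋ ⟧) V<n) ⟩
      ∑[ r < n ] ⟦ ⌊ rowOf V r ≟K x ⌋ ⟧
        ≡⟨ ∑<-cong n (λ r r<n → cong (λ k → ⟦ ⌊ k ≟K x ⌋ ⟧) (cong₂ _,_ (sym (sameBlocks r r<n))
             (trans (perm-reverseˡ n V r) (sym (perm-reverseˡ n U r))))) ⟩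
      ∑[ r < n ] ⟦ ⌊ rowOf U r ≟K x ⌋ ⟧
        ≡⟨ ∑<-perm-< n U (λ y → ⟦ ⌊ (block b y , perm n (reverse U) y) ≟K x ⌋ ⟧) U<n ⟩
      ∑[ y < n ] ⟦ ⌊ (block b y , perm n (reverse U) y) ≟K x ⌋ ⟧ ∎
    where
    open ≡-Reasoning
    _≟K_ : DecidableEquality (ℕ × ℕ)
    _≟K_ = ℕ×-≟ _≟_
    rowOf : List ℕ → ℕ → ℕ × ℕ
    rowOf W r = block b (perm n W r) , perm n (reverse W) (perm n W r)

  sortColumns : ∀ U V → All (_< n) U → All (_< n) V →
    (∀ r → r < n → block b (perm n U r) ≡ block b (perm n V r)) →
    Σ (List ℕ) λ v → All (InBlockSwap n) v × (∀ r → r < n → perm n v (perm n U r) ≡ perm n V r)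
  sortColumns U V U<n V<n sameBlocks =
    invert (sortWithinBlocks n ≤-refl (perm n (reverse V)) (perm n (reverse U)) (inverseContent U V U<n V<n sameBlocks))
    where
    invert : SortsTo n (perm n (reverse V)) (perm n (reverse U)) →
      Σ (List ℕ) λ v → All (InBlockSwap n) v × (∀ r → r < n → perm n v (perm n U r) ≡ perm n V r)
    invert (v , swaps , sorted) = v , swaps , λ r r<n → begin
      perm n v (perm n U r)                              ≡⟨ sym (perm-reverseʳ n V _) ⟩
      perm n V (perm n (reverse V) (perm n v (perm n U r)))
                                                         ≡⟨ cong (perm n V) (sorted _ (perm-< n U r U<n r<n)) ⟩
      perm n V (perm n (reverse U) (perm n U r))         ≡⟨ cong (perm n V) (perm-reverseˡ n U r) ⟩
      perm n V r                                         ∎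
      where open ≡-Reasoning

  SignsAgreeOffLastBlock : SignedMap → SignedMap → Set
  SignsAgreeOffLastBlock X Y = ∀ r → r < n →
    proj₂ (X r) ≡ proj₂ (Y r) ⊎ (b n' ≡ true × block b (proj₁ (Y r)) ≡ block b n')

  flipColumns : ∀ (X Y : SignedMap) V → All (_< n) V →
    (∀ r → r < n → proj₁ (X r) ≡ perm n V r) → (∀ r → r < n → proj₁ (Y r) ≡ perm n V r) →
    SignsAgreeOffLastBlock X Y →
    Σ (List ℕ) λ f → All (Letter n b) f × (∀ r → r < n → actRight n f X r ≡ Y r)
  flipColumns X Y V V<n X≡V Y≡V signs = flipMismatches (flipSigns n' b Q lastBlock idSigned n ≤-refl)
    where
    rowOf : ℕ → ℕ
    rowOf y = perm n (reverse V) y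
    Q : ℕ → Bool
    Q y = not ⌊ proj₂ (X (rowOf y)) Bool.≟ proj₂ (Y (rowOf y)) ⌋
    lastBlock : ∀ y → y ≤ n' → Q y ≡ true → b n' ≡ true × block b y ≡ block b n'
    lastBlock y y≤n' Qy with proj₂ (X (rowOf y)) Bool.≟ proj₂ (Y (rowOf y))
                           | signs (rowOf y) (perm-< n (reverse V) y (All-reverse V V<n) (s≤s y≤n'))
    ... | no differ | inj₁ agree          = ⊥-elim (differ agree)
    ... | no _      | inj₂ (bn' , inLast) =
      bn' , trans (cong (block b) (sym (trans (Y≡V _ (perm-< n (reverse V) y (All-reverse V V<n) (s≤s y≤n')))
                                              (perm-reverseʳ n V y)))) inLast
    flippedSign : ∀ r → r < n → proj₂ (X r) xor (flipBelow n Q (proj₁ (X r)) xor false) ≡ proj₂ (Y r)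
    flippedSign r r<n rewrite Bool.xor-identityʳ (flipBelow n Q (proj₁ (X r))) | X≡V r r<n
                            | flipBelow-< Q n (perm n V r) (perm-< n V r V<n r<n)
                            | perm-reverseˡ n V r = xor-not-≟ (proj₂ (X r)) (proj₂ (Y r))
    flipMismatches : (Σ (List ℕ) λ f → All (Letter n b) f ×
                       (∀ y → signed n f y ≡ flipIf (flipBelow n Q y) (y , false))) →
                     Σ (List ℕ) λ f → All (Letter n b) f × (∀ r → r < n → actRight n f X r ≡ Y r)
    flipMismatches (f , letters , flipped) = f , letters , λ r r<n →
      trans (apply-cong (signed n f) (λ y → flipIf (flipBelow n Q y) (y , false)) (X r) (flipped (proj₁ (X r))))
            (cong₂ _,_ (trans (X≡V r r<n) (sym (Y≡V r r<n))) (flippedSign r r<n))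

  matchColumns : ∀ (X Y : SignedMap) U V → All (_< n) U → All (_< n) V →
    (∀ r → r < n → proj₁ (X r) ≡ perm n U r) → (∀ r → r < n → proj₁ (Y r) ≡ perm n V r) →
    (∀ r → r < n → block b (proj₁ (X r)) ≡ block b (proj₁ (Y r))) → SignsAgreeOffLastBlock X Y →
    Σ (List ℕ) λ v → All (Letter n b) v × (∀ r → r < n → actRight n v X r ≡ Y r)
  matchColumns X Y U V U<n V<n X≡U Y≡V blocks signs = thenFlip (sortColumns U V U<n V<n sameBlocks)
    where
    sameBlocks : ∀ r → r < n → block b (perm n U r) ≡ block b (perm n V r)
    sameBlocks r r<n = subst₂ (λ x y → block b x ≡ block b y) (X≡U r r<n) (Y≡V r r<n) (blocks r r<n)
    thenFlip : (Σ (List ℕ) λ v → All (InBlockSwap n) v × (∀ r → r < n → perm n v (perm n U r) ≡ perm n V r)) →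
               Σ (List ℕ) λ v → All (Letter n b) v × (∀ r → r < n → actRight n v X r ≡ Y r)
    thenFlip (v , swaps , sorted) = prepend (flipColumns (actRight n v X) Y V V<n sortedX Y≡V signsX)
      where
      sortedX-r : ∀ r → actRight n v X r ≡ (perm n v (proj₁ (X r)) , proj₂ (X r))
      sortedX-r r rewrite actLeft-swaps n v idSigned (proj₁ (X r)) (All.map proj₁ swaps) =
        cong (perm n v (proj₁ (X r)) ,_) (Bool.xor-identityʳ _)
      sortedX : ∀ r → r < n → proj₁ (actRight n v X r) ≡ perm n V r
      sortedX r r<n = trans (cong proj₁ (sortedX-r r)) (trans (cong (perm n v) (X≡U r r<n)) (sorted r r<n))
      signsX : SignsAgreeOffLastBlock (actRight n v X) Y
      signsX r r<n = subst (λ s → s ≡ proj₂ (Y r) ⊎ (b n' ≡ true × block b (proj₁ (Y r)) ≡ block b n'))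
                           (sym (cong proj₂ (sortedX-r r))) (signs r r<n)
      prepend : (Σ (List ℕ) λ f → All (Letter n b) f × (∀ r → r < n → actRight n f (actRight n v X) r ≡ Y r)) →
                Σ (List ℕ) λ v → All (Letter n b) v × (∀ r → r < n → actRight n v X r ≡ Y r)
      prepend (f , letters , flipped) = v ++ f , ++⁺ (All.map InBlockSwap⇒Letter swaps) letters ,
        λ r r<n → trans (actRight-++ n v f X r) (flipped r r<n)

-- Margin conditions

bitAt : List Bool → ℕ → Bool
bitAt []       k       = true
bitAt (b ∷ bs) zero    = b
bitAt (b ∷ bs) (suc k) = bitAt bs k

nth : List ℕ → ℕ → ℕ
nth []       i       = 0
nth (x ∷ xs) zero    = x
nth (x ∷ xs) (suc i) = nth xs i

lookup≡nth : ∀ (xs : List ℕ) (i : Fin (length xs)) → lookup xs i ≡ nth xs (toℕ i)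
lookup≡nth (x ∷ xs) fzero    = refl
lookup≡nth (x ∷ xs) (fsuc i) = lookup≡nth xs i

block-∷ : ∀ x bs r → block (bitAt (x ∷ bs)) (suc r) ≡ ⟦ not x ⟧ + block (bitAt bs) r
block-∷ x bs r = ∑<-unfoldˡ r (λ k → ⟦ not (bitAt (x ∷ bs) k) ⟧)

-- The current block of compGo (suc c) already has c elements before the positions counted on the right.
nth-compGo : ∀ c bs i → nth (compGo (suc c) bs) i ≡
  (if i == 0 then c else 0) + ∑[ r < suc (length bs) ] ⟦ block (bitAt bs) r == i ⟧
nth-compGo c []           zero    = +-comm 1 c
nth-compGo c []           (suc i) = refl
nth-compGo c (true ∷ bs)  i       = trans (nth-compGo (suc c) bs i) (trans (moveOne i)
  (cong ((if i == 0 then c else 0) +_) (sym (trans (∑<-unfoldˡ (suc (length bs)) _)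
    (cong (⟦ 0 == i ⟧ +_) (∑<-cong (suc (length bs)) (λ r _ → cong (λ q → ⟦ q == i ⟧) (block-∷ true bs r))))))))
  where
  moveOne : ∀ i → (if i == 0 then suc c else 0) + ∑[ r < suc (length bs) ] ⟦ block (bitAt bs) r == i ⟧ ≡
    (if i == 0 then c else 0) + (⟦ 0 == i ⟧ + ∑[ r < suc (length bs) ] ⟦ block (bitAt bs) r == i ⟧)
  moveOne zero    = sym (+-suc c _)
  moveOne (suc i) = refl
nth-compGo c (false ∷ bs) zero    = sym (trans (cong (c +_) (trans (∑<-unfoldˡ (suc (length bs)) _)
  (cong (1 +_) (∑<-zero (suc (length bs)) (λ r _ → cong (λ q → ⟦ q == 0 ⟧) (block-∷ false bs r)))))) (+-comm c 1))
nth-compGo c (false ∷ bs) (suc i) = trans (nth-compGo 0 bs i) (trans (noHead i)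
  (sym (trans (∑<-unfoldˡ (suc (length bs)) _) (∑<-cong (suc (length bs))
    (λ r _ → trans (cong (λ q → ⟦ q == suc i ⟧) (block-∷ false bs r)) (cong ⟦_⟧ (==-suc (block (bitAt bs) r) i)))))))
  where
  noHead : ∀ i → (if i == 0 then 0 else 0) + ∑[ r < suc (length bs) ] ⟦ block (bitAt bs) r == i ⟧ ≡
                 ∑[ r < suc (length bs) ] ⟦ block (bitAt bs) r == i ⟧
  noHead zero    = refl
  noHead (suc i) = refl

length-compGo : ∀ c bs → length (compGo (suc c) bs) ≡ suc (block (bitAt bs) (length bs))
length-compGo c []           = refl
length-compGo c (true ∷ bs)  = trans (length-compGo (suc c) bs) (cong suc (sym (block-∷ true bs (length bs))))
length-compGo c (false ∷ bs) = trans (cong suc (length-compGo 0 bs)) (cong suc (sym (block-∷ false bs (length bs))))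

bitAt-take : ∀ m xs k → k < m → bitAt (take m xs) k ≡ bitAt xs k
bitAt-take (suc m) []       k       _         = refl
bitAt-take (suc m) (x ∷ xs) zero    _         = refl
bitAt-take (suc m) (x ∷ xs) (suc k) (s≤s k<m) = bitAt-take m xs k k<m

or-drop : ∀ m (xs : List Bool) → length xs ≡ suc m → or (drop m xs) ≡ bitAt xs m
or-drop zero    (x ∷ [])  _  = ∨-identityʳ x
or-drop (suc m) (x ∷ xs) eq = or-drop m xs (suc-injective eq)

bits : ∀ {m} → Subset m → ℕ → Bool
bits I = bitAt (toList I)

module MarginOf (n' : ℕ) (I : Subset (suc n')) where

  open Margin (marginOf I)

  private
    bs : List Bool
    bs = take n' (toList I)

    length-bs : length bs ≡ n'
    length-bs = trans (length-take n' (toList I))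
      (trans (cong (n' ⊓_) (length-toList I)) (m≤n⇒m⊓n≡m (n≤1+n n')))

    block-bs : ∀ r → r ≤ n' → block (bitAt bs) r ≡ block (bits I) r
    block-bs r r≤n' = ∑<-cong r (λ k k<r → cong (⟦_⟧ ∘ not) (bitAt-take n' (toList I) k (<-≤-trans k<r r≤n')))

  nth-comp : ∀ i → nth comp i ≡ ∑[ r < suc n' ] ⟦ block (bits I) r == i ⟧
  nth-comp i = trans (nth-compGo 0 bs i) (trans (noHead i)
    (trans (cong (λ q → ∑[ r < suc q ] ⟦ block (bitAt bs) r == i ⟧) length-bs)
    (∑<-cong (suc n') (λ r r<n → cong (λ q → ⟦ q == i ⟧) (block-bs r (m<1+n⇒m≤n r<n))))))
    where
    noHead : ∀ i → (if i == 0 then 0 else 0) + ∑[ r < suc (length bs) ] ⟦ block (bitAt bs) r == i ⟧ ≡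
                   ∑[ r < suc (length bs) ] ⟦ block (bitAt bs) r == i ⟧
    noHead zero    = refl
    noHead (suc i) = refl

  length-comp : length comp ≡ suc (block (bits I) n')
  length-comp = trans (length-compGo 0 bs) (cong suc (trans (cong (block (bitAt bs)) length-bs) (block-bs n' ≤-refl)))

  lam≡bit : lam ≡ bits I n'
  lam≡bit = or-drop n' (toList I) (length-toList I)

∈⇒bit : ∀ {m} (V : Subset m) (k : Fin m) → k ∈ V → bits V (toℕ k) ≡ true
∈⇒bit (x ∷v V) fzero    here      = refl
∈⇒bit (x ∷v V) (fsuc k) (there p) = ∈⇒bit V k p

bit⇒∈ : ∀ {m} (V : Subset m) k (k<m : k < m) → bits V k ≡ true → fromℕ< k<m ∈ V
bit⇒∈ (x ∷v V) zero    (s≤s z≤n) refl = here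
bit⇒∈ (x ∷v V) (suc k) (s≤s k<m) bit  = there (bit⇒∈ V k k<m bit)

toWord : ∀ {m} (u : List ℕ) → All (_< m) u → Word m
toWord []      []           = []
toWord (k ∷ u) (k<m ∷ u<m) = fromℕ< k<m ∷ toWord u u<m

letters-toWord : ∀ {m} (u : List ℕ) (u<m : All (_< m) u) → letters (toWord u u<m) ≡ u
letters-toWord []      []           = refl
letters-toWord (k ∷ u) (k<m ∷ u<m) = cong₂ _∷_ (toℕ-fromℕ< k<m) (letters-toWord u u<m)

InW-toWord : ∀ {m} (V : Subset m) (u : List ℕ) (ls : All (Letter m (bits V)) u) → InW V (toWord u (All.map proj₁ ls))
InW-toWord V []      []                  = []
InW-toWord V (k ∷ u) ((k<m , bit) ∷ ls) = bit⇒∈ V k k<m bit ∷ InW-toWord V u ls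

InW⇒letters : ∀ {m} (V : Subset m) (u : Word m) → InW V u → All (Letter m (bits V)) (letters u)
InW⇒letters V []      []       = []
InW⇒letters V (k ∷ u) (k∈V ∷ u∈V) = (toℕ<n k , ∈⇒bit V k k∈V) ∷ InW⇒letters V u u∈V

part : Bool → ℕ × ℕ → ℕ
part false = proj₁
part true  = proj₂

_≟ᶜ_ : DecidableEquality (ℕ × Bool)
_≟ᶜ_ = ℕ×-≟ Bool._≟_

shiftColumn : ℕ × Bool → ℕ × Bool
shiftColumn (j , s) = suc j , s

-- The signed columns of a row of a signed contingency matrix, listed with multiplicity:
-- (0 , false) a⁺₀ times, (0 , true) a⁻₀ times, then the columns 1, 2, … likewise.
layout : ℕ → (ℕ → ℕ × ℕ) → ℕ → ℕ × Bool
layout zero    row t = 0 , false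
layout (suc l) row t =
  if ⌊ t <? proj₁ (row 0) ⌋ then (0 , false)
  else if ⌊ t <? ∣ row 0 ∣ₛ ⌋ then (0 , true)
  else shiftColumn (layout l (row ∘ suc) (t ∸ ∣ row 0 ∣ₛ))

layout-positive : ∀ l row t → t < proj₁ (row 0) → layout (suc l) row t ≡ (0 , false)
layout-positive l row t t<a with t <? proj₁ (row 0)
... | yes _   = refl
... | no t≮a = ⊥-elim (t≮a t<a)

layout-negative : ∀ l row t → proj₁ (row 0) ≤ t → t < ∣ row 0 ∣ₛ → layout (suc l) row t ≡ (0 , true)
layout-negative l row t a≤t t<a+b with t <? proj₁ (row 0)
... | yes t<a = ⊥-elim (<⇒≱ t<a a≤t)
... | no _ with t <? ∣ row 0 ∣ₛ
...   | yes _     = refl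
...   | no t≮a+b = ⊥-elim (t≮a+b t<a+b)

layout-rest : ∀ l row t → layout (suc l) row (∣ row 0 ∣ₛ + t) ≡ shiftColumn (layout l (row ∘ suc) t)
layout-rest l row t with ∣ row 0 ∣ₛ + t <? proj₁ (row 0)
... | yes lt = ⊥-elim (<⇒≱ lt (≤-trans (m≤m+n (proj₁ (row 0)) (proj₂ (row 0))) (m≤m+n _ t)))
... | no _ with ∣ row 0 ∣ₛ + t <? ∣ row 0 ∣ₛ
...   | yes lt = ⊥-elim (<⇒≱ lt (m≤m+n _ t))
...   | no _   = cong (shiftColumn ∘ layout l (row ∘ suc)) (m+n∸m≡n (∣ row 0 ∣ₛ) t)

⟦shiftColumn≟suc⟧ : ∀ c j s → ⟦ ⌊ shiftColumn c ≟ᶜ (suc j , s) ⌋ ⟧ ≡ ⟦ ⌊ c ≟ᶜ (j , s) ⌋ ⟧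
⟦shiftColumn≟suc⟧ (x , t) j s = trans (⟦ℕ×-≟⟧ Bool._≟_ (suc x) t (suc j) s)
  (trans (cong (λ q → ⟦ q ⟧ * ⟦ ⌊ t Bool.≟ s ⌋ ⟧) (==-suc x j)) (sym (⟦ℕ×-≟⟧ Bool._≟_ x t j s)))

⟦shiftColumn≟0⟧ : ∀ c s → ⟦ ⌊ shiftColumn c ≟ᶜ (0 , s) ⌋ ⟧ ≡ 0
⟦shiftColumn≟0⟧ (x , t) s = ⟦ℕ×-≟⟧ Bool._≟_ (suc x) t 0 s

count-layout : ∀ l row → (∀ j → l ≤ j → row j ≡ (0 , 0)) → ∀ j s →
  count _≟ᶜ_ (∑[ j < l ] ∣ row j ∣ₛ) (layout l row) (j , s) ≡ part s (row j)
count-layout zero    row empty j false = sym (cong proj₁ (empty j z≤n))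
count-layout zero    row empty j true  = sym (cong proj₂ (empty j z≤n))
count-layout (suc l) row empty j s = begin
  ∑< (∑[ j < suc l ] ∣ row j ∣ₛ) F
    ≡⟨ cong (λ q → ∑< q F) (∑<-unfoldˡ l (λ j → ∣ row j ∣ₛ)) ⟩
  ∑< (a + b + total') F
    ≡⟨ ∑<-split (a + b) total' F ⟩
  ∑< (a + b) F + ∑[ t < total' ] F (a + b + t)
    ≡⟨ cong₂ _+_ (∑<-split a b F) (∑<-cong total' (λ t _ → cong (λ q → ⟦ ⌊ q ≟ᶜ (j , s) ⌋ ⟧) (layout-rest l row t))) ⟩
  ∑< a F + ∑[ t < b ] F (a + t) + ∑[ t < total' ] ⟦ ⌊ shiftColumn (layout l row' t) ≟ᶜ (j , s) ⌋ ⟧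
    ≡⟨ cong₂ (λ x y → x + y + ∑[ t < total' ] ⟦ ⌊ shiftColumn (layout l row' t) ≟ᶜ (j , s) ⌋ ⟧)
         (trans (∑<-cong a (λ t t<a → cong (λ q → ⟦ ⌊ q ≟ᶜ (j , s) ⌋ ⟧) (layout-positive l row t t<a))) (∑<-const a _))
         (trans (∑<-cong b (λ t t<b → cong (λ q → ⟦ ⌊ q ≟ᶜ (j , s) ⌋ ⟧)
                  (layout-negative l row (a + t) (m≤m+n a t) (+-monoʳ-< a t<b)))) (∑<-const b _)) ⟩
  a * ⟦ ⌊ (0 , false) ≟ᶜ (j , s) ⌋ ⟧ + b * ⟦ ⌊ (0 , true) ≟ᶜ (j , s) ⌋ ⟧
    + ∑[ t < total' ] ⟦ ⌊ shiftColumn (layout l row' t) ≟ᶜ (j , s) ⌋ ⟧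
    ≡⟨ byColumn j s ⟩
  part s (row j) ∎
  where
  open ≡-Reasoning
  F : ℕ → ℕ
  F t = ⟦ ⌊ layout (suc l) row t ≟ᶜ (j , s) ⌋ ⟧
  a b : ℕ
  a = proj₁ (row 0)
  b = proj₂ (row 0)
  row' : ℕ → ℕ × ℕ
  row' = row ∘ suc
  total' : ℕ
  total' = ∑[ j < l ] ∣ row' j ∣ₛ
  byColumn : ∀ j s → a * ⟦ ⌊ (0 , false) ≟ᶜ (j , s) ⌋ ⟧ + b * ⟦ ⌊ (0 , true) ≟ᶜ (j , s) ⌋ ⟧
    + ∑[ t < total' ] ⟦ ⌊ shiftColumn (layout l row' t) ≟ᶜ (j , s) ⌋ ⟧ ≡ part s (row j)
  byColumn zero false
    rewrite ∑<-zero total' (λ t _ → ⟦shiftColumn≟0⟧ (layout l row' t) false) | *-identityʳ a | *-zeroʳ b =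
    trans (+-identityʳ _) (+-identityʳ a)
  byColumn zero true
    rewrite ∑<-zero total' (λ t _ → ⟦shiftColumn≟0⟧ (layout l row' t) true) | *-identityʳ b | *-zeroʳ a =
    +-identityʳ b
  byColumn (suc j) s rewrite *-zeroʳ a | *-zeroʳ b =
    trans (∑<-cong total' (λ t _ → ⟦shiftColumn≟suc⟧ (layout l row' t) j s))
          (count-layout l row' (λ j l≤j → empty (suc j) (s≤s l≤j)) j s)

zeroExtend : ∀ {k l} → (Fin k → Fin l → ℕ × ℕ) → ℕ → ℕ → ℕ × ℕ
zeroExtend {k} {l} e i j with i <? k | j <? l
... | yes i<k | yes j<l = e (fromℕ< i<k) (fromℕ< j<l)
... | yes _   | no _    = 0 , 0
... | no _    | _       = 0 , 0

zeroExtend-fromℕ< : ∀ {k l} (e : Fin k → Fin l → ℕ × ℕ) i j (i<k : i < k) (j<l : j < l) →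
  zeroExtend e i j ≡ e (fromℕ< i<k) (fromℕ< j<l)
zeroExtend-fromℕ< {k} {l} e i j i<k j<l with i <? k | j <? l
... | yes p   | yes q   = cong₂ (λ p q → e (fromℕ< p) (fromℕ< q)) (<-irrelevant p i<k) (<-irrelevant q j<l)
... | yes _   | no j≮l = ⊥-elim (j≮l j<l)
... | no i≮k | _       = ⊥-elim (i≮k i<k)

zeroExtend-toℕ : ∀ {k l} (e : Fin k → Fin l → ℕ × ℕ) i j → zeroExtend e (toℕ i) (toℕ j) ≡ e i j
zeroExtend-toℕ e i j = trans (zeroExtend-fromℕ< e (toℕ i) (toℕ j) (toℕ<n i) (toℕ<n j))
                         (cong₂ e (fromℕ<-toℕ i (toℕ<n i)) (fromℕ<-toℕ j (toℕ<n j)))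

zeroExtend-outside : ∀ {k l} (e : Fin k → Fin l → ℕ × ℕ) i j → k ≤ i ⊎ l ≤ j → zeroExtend e i j ≡ (0 , 0)
zeroExtend-outside {k} {l} e i j outside with i <? k | j <? l | outside
... | yes i<k | yes _   | inj₁ k≤i = ⊥-elim (<⇒≱ i<k k≤i)
... | yes _   | yes j<l | inj₂ l≤j = ⊥-elim (<⇒≱ j<l l≤j)
... | yes _   | no _    | _         = refl
... | no _    | _       | _         = refl

-- The signed contingency matrix of a word

module Tally (n' : ℕ) (I J : Subset (suc n')) where

  n : ℕ
  n = suc n'

  bI bJ : ℕ → Bool
  bI = bits I
  bJ = bits J

  rowBlock colBlock : ℕ → ℕ
  rowBlock = block bI
  colBlock = block bJ

  α β : Margin
  α = marginOf I
  β = marginOf J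

  kα kβ : ℕ
  kα = length (Margin.comp α)
  kβ = length (Margin.comp β)

  module MI = MarginOf n' I
  module MJ = MarginOf n' J

  -- Signs in the last block of a margin with λ = 1 can be changed by the parabolic subgroup,
  -- so they are not recorded.
  rowHidden colHidden rowVisible colVisible : ℕ → Bool
  rowHidden a = bI n' ∧ (a == rowBlock n')
  colHidden c = bJ n' ∧ (c == colBlock n')
  rowVisible a = not (rowHidden a)
  colVisible c = not (colHidden c)

  visibleSign : ℕ → Signed → Bool
  visibleSign a e = proj₂ e ∧ (rowVisible a ∧ colVisible (colBlock (proj₁ e)))

  keyAt : ℕ → Signed → ℕ × ℕ × Bool
  keyAt a e = a , colBlock (proj₁ e) , visibleSign a e

  _≟K_ : DecidableEquality (ℕ × ℕ × Bool)
  _≟K_ = ℕ×-≟ _≟ᶜ_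

  key : SignedMap → ℕ → ℕ × ℕ × Bool
  key X r = keyAt (rowBlock r) (X r)

  colourOf : SignedMap → ℕ → ℕ × Bool
  colourOf X r = colBlock (proj₁ (X r)) , visibleSign (rowBlock r) (X r)

  tallyBy : (ℕ → ℕ × Bool) → ℕ × ℕ × Bool → ℕ
  tallyBy c = count _≟K_ n (λ r → rowBlock r , c r)

  tally : SignedMap → ℕ × ℕ × Bool → ℕ
  tally X = tallyBy (colourOf X)

  Valid : SignedMap → Set
  Valid X = ∀ r → r < n → proj₁ (X r) < n

  wordMap : Word n → SignedMap
  wordMap w = signed n (letters w)

  proj₁-wordMap : ∀ w r → proj₁ (wordMap w r) ≡ perm n (letters w) r
  proj₁-wordMap w r = proj₁-actLeft n (letters w) idSigned r

  wordMap-valid : ∀ w → Valid (wordMap w)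
  wordMap-valid w r r<n = subst (_< n) (sym (proj₁-wordMap w r)) (perm-< n (letters w) r (letters-< w) r<n)

  kα≡ : kα ≡ suc (rowBlock n')
  kα≡ = MI.length-comp

  kβ≡ : kβ ≡ suc (colBlock n')
  kβ≡ = MJ.length-comp

  rowBlock<kα : ∀ r → r < n → rowBlock r < kα
  rowBlock<kα r r<n = subst (rowBlock r <_) (sym kα≡) (s≤s (block-mono bI (m<1+n⇒m≤n r<n)))

  colBlock<kβ : ∀ x → x < n → colBlock x < kβ
  colBlock<kβ x x<n = subst (colBlock x <_) (sym kβ≡) (s≤s (block-mono bJ (m<1+n⇒m≤n x<n)))

  ⟦≟K⟧-signs : ∀ a c s i j → ⟦ ⌊ (a , c , s) ≟K (i , j , false) ⌋ ⟧ + ⟦ ⌊ (a , c , s) ≟K (i , j , true) ⌋ ⟧ ≡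
                              ⟦ a == i ⟧ * ⟦ c == j ⟧
  ⟦≟K⟧-signs a c s i j with a ≟ i | c ≟ j
  ⟦≟K⟧-signs a c true  i j | yes refl | yes refl = refl
  ⟦≟K⟧-signs a c false i j | yes refl | yes refl = refl
  ...                      | yes refl | no _     = refl
  ...                      | no _     | _        = refl

  tallyBy-signs : ∀ c i j → tallyBy c (i , j , false) + tallyBy c (i , j , true) ≡
                             ∑[ r < n ] (⟦ rowBlock r == i ⟧ * ⟦ proj₁ (c r) == j ⟧)
  tallyBy-signs c i j = trans (sym (∑<-distrib-+ n _ _))
    (∑<-cong n (λ r _ → ⟦≟K⟧-signs (rowBlock r) (proj₁ (c r)) (proj₂ (c r)) i j))

  tallyBy-rowSum : ∀ c → (∀ r → r < n → proj₁ (c r) < kβ) → ∀ i →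
    ∑[ j < kβ ] (tallyBy c (i , j , false) + tallyBy c (i , j , true)) ≡ ∑[ r < n ] ⟦ rowBlock r == i ⟧
  tallyBy-rowSum c c<kβ i = begin
    ∑[ j < kβ ] (tallyBy c (i , j , false) + tallyBy c (i , j , true))
      ≡⟨ ∑<-cong kβ (λ j _ → tallyBy-signs c i j) ⟩
    ∑[ j < kβ ] ∑[ r < n ] (⟦ rowBlock r == i ⟧ * ⟦ proj₁ (c r) == j ⟧)
      ≡⟨ sym (∑<-comm n kβ _) ⟩
    ∑[ r < n ] ∑[ j < kβ ] (⟦ rowBlock r == i ⟧ * ⟦ proj₁ (c r) == j ⟧)
      ≡⟨ ∑<-cong n (λ r r<n → trans (∑<-distribˡ-* kβ ⟦ rowBlock r == i ⟧ (λ j → ⟦ proj₁ (c r) == j ⟧))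
           (trans (cong (⟦ rowBlock r == i ⟧ *_) (∑<-indicator kβ _ (c<kβ r r<n))) (*-identityʳ _))) ⟩
    ∑[ r < n ] ⟦ rowBlock r == i ⟧ ∎
    where open ≡-Reasoning

  tallyBy-colSum : ∀ c j →
    ∑[ i < kα ] (tallyBy c (i , j , false) + tallyBy c (i , j , true)) ≡ ∑[ r < n ] ⟦ proj₁ (c r) == j ⟧
  tallyBy-colSum c j = begin
    ∑[ i < kα ] (tallyBy c (i , j , false) + tallyBy c (i , j , true))
      ≡⟨ ∑<-cong kα (λ i _ → tallyBy-signs c i j) ⟩
    ∑[ i < kα ] ∑[ r < n ] (⟦ rowBlock r == i ⟧ * ⟦ proj₁ (c r) == j ⟧)
      ≡⟨ sym (∑<-comm n kα _) ⟩
    ∑[ r < n ] ∑[ i < kα ] (⟦ rowBlock r == i ⟧ * ⟦ proj₁ (c r) == j ⟧)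
      ≡⟨ ∑<-cong n (λ r r<n → trans (∑<-distribʳ-* kα ⟦ proj₁ (c r) == j ⟧ (λ i → ⟦ rowBlock r == i ⟧))
           (trans (cong (_* ⟦ proj₁ (c r) == j ⟧) (∑<-indicator kα _ (rowBlock<kα r r<n))) (+-identityʳ _))) ⟩
    ∑[ r < n ] ⟦ proj₁ (c r) == j ⟧ ∎
    where open ≡-Reasoning

  ∑-colBlock-wordMap : ∀ w j → ∑[ r < n ] ⟦ colBlock (proj₁ (wordMap w r)) == j ⟧ ≡ ∑[ r < n ] ⟦ colBlock r == j ⟧
  ∑-colBlock-wordMap w j = trans (∑<-cong n (λ r _ → cong (λ q → ⟦ colBlock q == j ⟧) (proj₁-wordMap w r)))
    (∑<-perm-< n (letters w) (λ r → ⟦ colBlock r == j ⟧) (letters-< w))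

  tally-invisible : ∀ X i j → rowVisible i ∧ colVisible j ≡ false → tally X (i , j , true) ≡ 0
  tally-invisible X i j invisible = ∑<-zero n λ r _ → term (rowBlock r) (colBlock (proj₁ (X r))) (proj₂ (X r))
    where
    term : ∀ a c s → ⟦ ⌊ (a , c , s ∧ (rowVisible a ∧ colVisible c)) ≟K (i , j , true) ⌋ ⟧ ≡ 0
    term a c s with a ≟ i | c ≟ j
    ... | no _     | _        = refl
    ... | yes refl | no _     = refl
    ... | yes refl | yes refl rewrite invisible | ∧-zeroʳ s = refl

  lastRow-invisible : ∀ j → bI n' ≡ true → rowVisible (rowBlock n') ∧ colVisible j ≡ false
  lastRow-invisible j λI rewrite λI | ==-refl (rowBlock n') = refl

  lastCol-invisible : ∀ i → bJ n' ≡ true → rowVisible i ∧ colVisible (colBlock n') ≡ false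
  lastCol-invisible i λJ rewrite λJ | ==-refl (colBlock n') = ∧-zeroʳ (rowVisible i)

  lastIndex : ∀ {k} (i : Fin k) → suc (toℕ i) ≡ k → ∀ {m} → k ≡ suc m → toℕ i ≡ m
  lastIndex i i+1≡k k≡1+m = suc-injective (trans i+1≡k k≡1+m)

  toSCM : Word n → SCM α β
  toSCM w = record
    { entry   = λ i j → tally (wordMap w) (toℕ i , toℕ j , false) , tally (wordMap w) (toℕ i , toℕ j , true)
    ; rowSum  = λ i → rowSums i
    ; colSum  = λ j → colSums j
    ; lastRow = λ λα i j last → subst (λ a → tally (wordMap w) (a , toℕ j , true) ≡ 0) (sym (lastIndex i last kα≡))
                  (tally-invisible (wordMap w) _ (toℕ j) (lastRow-invisible (toℕ j) (trans (sym MI.lam≡bit) λα)))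
    ; lastCol = λ λβ i j last → subst (λ c → tally (wordMap w) (toℕ i , c , true) ≡ 0) (sym (lastIndex j last kβ≡))
                  (tally-invisible (wordMap w) (toℕ i) _ (lastCol-invisible (toℕ i) (trans (sym MJ.lam≡bit) λβ)))
    }
    where
    open ≡-Reasoning
    rowSums : ∀ i → sumℕ {kβ} (λ j → tally (wordMap w) (toℕ i , toℕ j , false) + tally (wordMap w) (toℕ i , toℕ j , true)) ≡
                         lookup (Margin.comp α) i
    rowSums i = begin
      sumℕ {kβ} (λ j → tally (wordMap w) (toℕ i , toℕ j , false) + tally (wordMap w) (toℕ i , toℕ j , true))
        ≡⟨ sumℕ≡∑< kβ (λ j → tally (wordMap w) (toℕ i , j , false) + tally (wordMap w) (toℕ i , j , true)) ⟩
      ∑[ j < kβ ] (tally (wordMap w) (toℕ i , j , false) + tally (wordMap w) (toℕ i , j , true))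
        ≡⟨ tallyBy-rowSum (colourOf (wordMap w)) (λ r r<n → colBlock<kβ _ (wordMap-valid w r r<n)) (toℕ i) ⟩
      ∑[ r < n ] ⟦ rowBlock r == toℕ i ⟧
        ≡⟨ sym (trans (lookup≡nth (Margin.comp α) i) (MI.nth-comp (toℕ i))) ⟩
      lookup (Margin.comp α) i ∎
    colSums : ∀ j → sumℕ {kα} (λ i → tally (wordMap w) (toℕ i , toℕ j , false) + tally (wordMap w) (toℕ i , toℕ j , true)) ≡
                         lookup (Margin.comp β) j
    colSums j = begin
      sumℕ {kα} (λ i → tally (wordMap w) (toℕ i , toℕ j , false) + tally (wordMap w) (toℕ i , toℕ j , true))
        ≡⟨ sumℕ≡∑< kα (λ i → tally (wordMap w) (i , toℕ j , false) + tally (wordMap w) (i , toℕ j , true)) ⟩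
      ∑[ i < kα ] (tally (wordMap w) (i , toℕ j , false) + tally (wordMap w) (i , toℕ j , true))
        ≡⟨ tallyBy-colSum (colourOf (wordMap w)) (toℕ j) ⟩
      ∑[ r < n ] ⟦ colBlock (proj₁ (wordMap w r)) == toℕ j ⟧
        ≡⟨ ∑-colBlock-wordMap w (toℕ j) ⟩
      ∑[ r < n ] ⟦ colBlock r == toℕ j ⟧
        ≡⟨ sym (trans (lookup≡nth (Margin.comp β) j) (MJ.nth-comp (toℕ j))) ⟩
      lookup (Margin.comp β) j ∎

  keyAt-negate : ∀ a e → rowVisible a ≡ false → keyAt a (negate e) ≡ keyAt a e
  keyAt-negate a e invisible rewrite invisible | ∧-zeroʳ (not (proj₂ e)) | ∧-zeroʳ (proj₂ e) = refl

  key-genAct : ∀ k → Letter n bI k → ∀ Y r → key (genAct n k Y) r ≡ key Y (genPerm n k r)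
  key-genAct k (k<n , bk) Y r with suc k ≟ n
  ... | no _ = cong (λ a → keyAt a (Y (swapℕ k r))) (sym (block-swapℕ bI k r bk))
  ... | yes 1+k≡n with r ≟ k
  ...   | no _     = refl
  ...   | yes refl = keyAt-negate (rowBlock r) (Y r) lastRowInvisible
    where
    lastRowInvisible : rowVisible (rowBlock r) ≡ false
    lastRowInvisible rewrite suc-injective 1+k≡n | bk | ==-refl (rowBlock n') = refl

  key-actLeft : ∀ u → All (Letter n bI) u → ∀ X r → key (actLeft n u X) r ≡ key X (perm n u r)
  key-actLeft []      []           X r = refl
  key-actLeft (k ∷ u) (l ∷ letters) X r =
    trans (key-genAct k l (actLeft n u X) r) (key-actLeft u letters X (genPerm n k r))

  tally-actLeft : ∀ u → All (Letter n bI) u → ∀ X x → tally (actLeft n u X) x ≡ tally X x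
  tally-actLeft u ls X x = trans (∑<-cong n (λ r _ → cong (λ q → ⟦ ⌊ q ≟K x ⌋ ⟧) (key-actLeft u ls X r)))
    (∑<-perm-< n u (λ r → ⟦ ⌊ key X r ≟K x ⌋ ⟧) (All.map proj₁ ls))

  signed-negative : ∀ v → All (Letter n bJ) v → ∀ x → proj₂ (signed n v x) ≡ true →
    bJ n' ≡ true × colBlock x ≡ colBlock n'
  signed-negative (k ∷ v) ((k<n , bk) ∷ ls) x negative with suc k ≟ n
  ... | no _ = let (λJ , lastCol) = signed-negative v ls (swapℕ k x) negative in
               λJ , trans (sym (block-swapℕ bJ k x bk)) lastCol
  ... | yes 1+k≡n with x ≟ k
  ...   | no _     = signed-negative v ls x negative
  ...   | yes refl = subst (λ q → bJ q ≡ true) (suc-injective 1+k≡n) bk , cong colBlock (suc-injective 1+k≡n)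

  colBlock-signed : ∀ v → All (Letter n bJ) v → ∀ x → colBlock (proj₁ (signed n v x)) ≡ colBlock x
  colBlock-signed v ls x = trans (cong colBlock (proj₁-actLeft n v idSigned x)) (block-perm n bJ v x (All.map proj₂ ls))

  key-actRight : ∀ v → All (Letter n bJ) v → ∀ X r → key (actRight n v X) r ≡ key X r
  key-actRight v ls X r = cong (rowBlock r ,_) (cong₂ _,_ sameCol (trans
      (cong (λ c → (proj₂ (X r) xor proj₂ (signed n v x)) ∧ (rowVisible (rowBlock r) ∧ colVisible c)) sameCol)
      (xorHidden (proj₂ (X r)) (proj₂ (signed n v x)) hidden)))
    where
    x : ℕ
    x = proj₁ (X r)
    sameCol : colBlock (proj₁ (signed n v x)) ≡ colBlock x
    sameCol = colBlock-signed v ls x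
    visible : Bool
    visible = rowVisible (rowBlock r) ∧ colVisible (colBlock x)
    hidden : proj₂ (signed n v x) ≡ true → visible ≡ false
    hidden negative with signed-negative v ls x negative
    ... | λJ , lastCol rewrite λJ | lastCol | ==-refl (colBlock n') = ∧-zeroʳ _
    xorHidden : ∀ s t → (t ≡ true → visible ≡ false) → (s xor t) ∧ visible ≡ s ∧ visible
    xorHidden s false _ = cong (_∧ visible) (Bool.xor-identityʳ s)
    xorHidden s true  h rewrite h refl = trans (∧-zeroʳ _) (sym (∧-zeroʳ s))

  tally-actRight : ∀ v → All (Letter n bJ) v → ∀ X x → tally (actRight n v X) x ≡ tally X x
  tally-actRight v ls X x = ∑<-cong n (λ r _ → cong (λ q → ⟦ ⌊ q ≟K x ⌋ ⟧) (key-actRight v ls X r))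

  tally-cong : ∀ {X Y} → (∀ r → r < n → X r ≡ Y r) → ∀ x → tally X x ≡ tally Y x
  tally-cong X≡Y x = ∑<-cong n (λ r r<n → cong (λ e → ⟦ ⌊ keyAt (rowBlock r) e ≟K x ⌋ ⟧) (X≡Y r r<n))

  doubleCoset : Word n → Word n → Word n → SignedMap
  doubleCoset u w v = actRight n (letters v) (actLeft n (letters u) (wordMap w))

  mat-doubleCoset : ∀ u w v → ((mat u · mat w) · mat v) ≈M permMatrix (doubleCoset u w v)
  mat-doubleCoset u w v =
    ≈M-trans (·-cong (·-cong (mat≈permMatrix n u) (mat≈permMatrix n w)) (mat≈permMatrix n v))
    (≈M-trans (·-cong {n} {permMatrix (wordMap u) · permMatrix (wordMap w)} {permMatrix (wordMap u ⊙ wordMap w)} {permMatrix (wordMap v)}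
                 (permMatrix-⊙ n (wordMap u) (wordMap w) (wordMap-valid u)) (λ _ _ → refl))
    (≈M-trans (permMatrix-⊙ n (wordMap u ⊙ wordMap w) (wordMap v) (λ r r<n → wordMap-valid w _ (wordMap-valid u r r<n)))
              (permMatrix-cong (λ r _ → cong (apply (wordMap v)) (sym (actLeft≗signed-⊙ n (letters u) (wordMap w) r))))))

  doubleCoset-valid : ∀ u w v → Valid (doubleCoset u w v)
  doubleCoset-valid u w v r r<n = subst (_< n) (sym (trans (proj₁-actLeft n (letters v) idSigned _)
      (cong (perm n (letters v)) (proj₁-actLeft n (letters u) (wordMap w) r))))
    (perm-< n (letters v) _ (letters-< v) (wordMap-valid w _ (perm-< n (letters u) r (letters-< u) r<n)))

  toSCM-respects-doubleCoset : ∀ w w' → SameDoubleCoset I J w w' → toSCM w ≈SCM toSCM w'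
  toSCM-respects-doubleCoset w w' (u , v , u∈I , v∈J , uwv≈w') i j = sym (cong₂ _,_ (sameTally _) (sameTally _))
    where
    X : SignedMap
    X = doubleCoset u w v
    X≡w' : ∀ r → r < n → X r ≡ wordMap w' r
    X≡w' = permMatrix-injective n X (wordMap w')
      (≈M-trans (≈M-sym (mat-doubleCoset u w v)) (≈M-trans uwv≈w' (mat≈permMatrix n w'))) (doubleCoset-valid u w v)
    sameTally : ∀ x → tally (wordMap w') x ≡ tally (wordMap w) x
    sameTally x = begin
      tally (wordMap w') x  ≡⟨ sym (tally-cong X≡w' x) ⟩
      tally X x       ≡⟨ tally-actRight (letters v) (InW⇒letters J v v∈J) (actLeft n (letters u) (wordMap w)) x ⟩
      tally (actLeft n (letters u) (wordMap w)) x ≡⟨ tally-actLeft (letters u) (InW⇒letters I u u∈I) (wordMap w) x ⟩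
      tally (wordMap w) x   ∎
      where open ≡-Reasoning

  tally-outside : ∀ X → Valid X → ∀ i j s → kα ≤ i ⊎ kβ ≤ j → tally X (i , j , s) ≡ 0
  tally-outside X valid i j s outside =
    ∑<-zero n λ r r<n → term r r<n (rowBlock r) refl (colBlock (proj₁ (X r))) refl outside
    where
    term : ∀ r → r < n → ∀ a → rowBlock r ≡ a → ∀ c → colBlock (proj₁ (X r)) ≡ c → kα ≤ i ⊎ kβ ≤ j →
           ⟦ ⌊ (a , c , visibleSign a (X r)) ≟K (i , j , s) ⌋ ⟧ ≡ 0
    term r r<n a ra c xc out with a ≟ i | c ≟ j | out
    ... | no _     | _        | _          = refl
    ... | yes refl | no _     | _          = refl
    ... | yes refl | yes refl | inj₁ kα≤a = ⊥-elim (<⇒≱ (subst (_< kα) ra (rowBlock<kα r r<n)) kα≤a)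
    ... | yes refl | yes refl | inj₂ kβ≤c = ⊥-elim (<⇒≱ (subst (_< kβ) xc (colBlock<kβ _ (valid r r<n))) kβ≤c)

  tally-≈SCM : ∀ w w' → toSCM w ≈SCM toSCM w' → ∀ x → tally (wordMap w) x ≡ tally (wordMap w') x
  tally-≈SCM w w' same (i , j , s) with i <? kα | j <? kβ
  ... | yes i<kα | yes j<kβ = subst₂ (λ a c → tally (wordMap w) (a , c , s) ≡ tally (wordMap w') (a , c , s))
                                (toℕ-fromℕ< i<kα) (toℕ-fromℕ< j<kβ) (entryPart s (same (fromℕ< i<kα) (fromℕ< j<kβ)))
    where
    entryPart : ∀ s {a c} → SCM.entry (toSCM w) a c ≡ SCM.entry (toSCM w') a c →
                tally (wordMap w) (toℕ a , toℕ c , s) ≡ tally (wordMap w') (toℕ a , toℕ c , s)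
    entryPart false = cong proj₁
    entryPart true  = cong proj₂
  ... | no i≮kα | _        = trans (tally-outside (wordMap w) (wordMap-valid w) i j s (inj₁ (≮⇒≥ i≮kα)))
                                   (sym (tally-outside (wordMap w') (wordMap-valid w') i j s (inj₁ (≮⇒≥ i≮kα))))
  ... | yes _   | no j≮kβ = trans (tally-outside (wordMap w) (wordMap-valid w) i j s (inj₂ (≮⇒≥ j≮kβ)))
                                   (sym (tally-outside (wordMap w') (wordMap-valid w') i j s (inj₂ (≮⇒≥ j≮kβ))))

  open Sorting _≟ᶜ_ n bI using (SortsTo; InBlockSwap⇒Letter; sortWithinBlocks)
  open ColumnMatching n' bJ using (SignsAgreeOffLastBlock; matchColumns)

  sortRows : ∀ X Y → (∀ x → tally X x ≡ tally Y x) →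
    Σ (List ℕ) λ u → All (Letter n bI) u × (∀ r → r < n → colourOf (actLeft n u X) r ≡ colourOf Y r)
  sortRows X Y sameTally = onRows (sortWithinBlocks n ≤-refl (colourOf X) (colourOf Y) sameTally)
    where
    onRows : SortsTo n (colourOf X) (colourOf Y) →
      Σ (List ℕ) λ u → All (Letter n bI) u × (∀ r → r < n → colourOf (actLeft n u X) r ≡ colourOf Y r)
    onRows (u , swaps , sorted) = u , All.map InBlockSwap⇒Letter swaps , λ r r<n → begin
      colourOf (actLeft n u X) r
        ≡⟨ cong (λ e → colBlock (proj₁ e) , visibleSign (rowBlock r) e) (actLeft-swaps n u X r (All.map proj₁ swaps)) ⟩
      colBlock (proj₁ (X (perm n u r))) , visibleSign (rowBlock r) (X (perm n u r))
        ≡⟨ cong (λ a → colBlock (proj₁ (X (perm n u r))) , visibleSign a (X (perm n u r)))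
                (sym (block-perm n bI u r (All.map proj₂ swaps))) ⟩
      colourOf X (perm n u r)
        ≡⟨ sorted r r<n ⟩
      colourOf Y r ∎
      where open ≡-Reasoning

  hidden⇒last : ∀ (b : ℕ → Bool) {a last} → b n' ∧ (a == last) ≡ true → b n' ≡ true × a ≡ last
  hidden⇒last b {a} {last} hidden with b n' | a == last in a==last
  ... | true | true = refl , ==⇒≡ a==last

  ReadyForColumns : SignedMap → SignedMap → Set
  ReadyForColumns X Y = (∀ r → r < n → colBlock (proj₁ (X r)) ≡ colBlock (proj₁ (Y r))) × SignsAgreeOffLastBlock X Y

  -- Where the signs still differ, either the row sign is invisible (and flipped here) or the
  -- column sign is, which is left to the columns.
  flipRows : ∀ X Y → (∀ r → r < n → colourOf X r ≡ colourOf Y r) →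
    Σ (List ℕ) λ f → All (Letter n bI) f × ReadyForColumns (actLeft n f X) Y
  flipRows X Y sameColour = flipMismatches (flipSigns n' bI Q lastRow X n ≤-refl)
    where
    Q : ℕ → Bool
    Q r = rowHidden (rowBlock r) ∧ not ⌊ proj₂ (X r) Bool.≟ proj₂ (Y r) ⌋
    lastRow : ∀ r → r ≤ n' → Q r ≡ true → bI n' ≡ true × rowBlock r ≡ rowBlock n'
    lastRow r _ Qr with rowHidden (rowBlock r) in hidden
    ... | true = hidden⇒last bI hidden
    flipMismatches : (Σ (List ℕ) λ f → All (Letter n bI) f × (∀ x → actLeft n f X x ≡ flipIf (flipBelow n Q x) (X x))) →
      Σ (List ℕ) λ f → All (Letter n bI) f × ReadyForColumns (actLeft n f X) Y
    flipMismatches (f , letters , flipped) = f , letters , sameCol , signs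
      where
      flipped< : ∀ r → r < n → actLeft n f X r ≡ flipIf (Q r) (X r)
      flipped< r r<n = trans (flipped r) (cong (λ q → flipIf q (X r)) (flipBelow-< Q n r r<n))
      sameCol : ∀ r → r < n → colBlock (proj₁ (actLeft n f X r)) ≡ colBlock (proj₁ (Y r))
      sameCol r r<n = trans (cong (colBlock ∘ proj₁) (flipped< r r<n)) (cong proj₁ (sameColour r r<n))
      signs : SignsAgreeOffLastBlock (actLeft n f X) Y
      signs r r<n with fixedSign (proj₂ (X r)) (proj₂ (Y r)) (rowHidden (rowBlock r)) (colVisible (colBlock (proj₁ (Y r))))
                         (trans (cong (λ c → proj₂ (X r) ∧ (rowVisible (rowBlock r) ∧ colVisible c)) (sym (cong proj₁ (sameColour r r<n))))
                                (cong proj₂ (sameColour r r<n)))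
      ... | inj₁ fixed  = inj₁ (trans (cong proj₂ (flipped< r r<n)) fixed)
      ... | inj₂ hidden = inj₂ (hidden⇒last bJ (Bool.not-injective hidden))

  matchRows : ∀ X Y → (∀ x → tally X x ≡ tally Y x) →
    Σ (List ℕ) λ u → All (Letter n bI) u × ReadyForColumns (actLeft n u X) Y
  matchRows X Y sameTally = thenFlip (sortRows X Y sameTally)
    where
    thenFlip : (Σ (List ℕ) λ s → All (Letter n bI) s × (∀ r → r < n → colourOf (actLeft n s X) r ≡ colourOf Y r)) →
      Σ (List ℕ) λ u → All (Letter n bI) u × ReadyForColumns (actLeft n u X) Y
    thenFlip (s , sI , sorted) = prepend (flipRows (actLeft n s X) Y sorted)
      where
      prepend : (Σ (List ℕ) λ f → All (Letter n bI) f × ReadyForColumns (actLeft n f (actLeft n s X)) Y) →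
        Σ (List ℕ) λ u → All (Letter n bI) u × ReadyForColumns (actLeft n u X) Y
      prepend (f , fI , ready) = f ++ s , ++⁺ fI sI , subst (λ Z → ReadyForColumns Z Y) (sym (actLeft-++ n f s X)) ready

  matchDoubleCoset : ∀ w w' → (∀ x → tally (wordMap w) x ≡ tally (wordMap w') x) →
    Σ (List ℕ) λ u → Σ (List ℕ) λ v → All (Letter n bI) u × All (Letter n bJ) v ×
      (∀ r → r < n → actRight n v (actLeft n u (wordMap w)) r ≡ wordMap w' r)
  matchDoubleCoset w w' sameTally = thenColumns (matchRows (wordMap w) (wordMap w') sameTally)
    where
    thenColumns : (Σ (List ℕ) λ u → All (Letter n bI) u × ReadyForColumns (actLeft n u (wordMap w)) (wordMap w')) →
      Σ (List ℕ) λ u → Σ (List ℕ) λ v → All (Letter n bI) u × All (Letter n bJ) v ×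
        (∀ r → r < n → actRight n v (actLeft n u (wordMap w)) r ≡ wordMap w' r)
    thenColumns (u , uI , sameCol , signs) = u , proj₁ columns , uI , proj₂ columns
      where
      positions : ∀ r → r < n → proj₁ (actLeft n u (wordMap w) r) ≡ perm n (u ++ letters w) r
      positions r _ = trans (proj₁-actLeft n u (wordMap w) r) (trans (proj₁-wordMap w _) (sym (perm-++ n u (letters w) r)))
      columns : Σ (List ℕ) λ v → All (Letter n bJ) v × (∀ r → r < n → actRight n v (actLeft n u (wordMap w)) r ≡ wordMap w' r)
      columns = matchColumns (actLeft n u (wordMap w)) (wordMap w') (u ++ letters w) (letters w')
                  (++⁺ (All.map proj₁ uI) (letters-< w)) (letters-< w') positions (λ r _ → proj₁-wordMap w' r) sameCol signs

  toSCM-injective : ∀ w w' → toSCM w ≈SCM toSCM w' → SameDoubleCoset I J w w'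
  toSCM-injective w w' same = asWords (matchDoubleCoset w w' (tally-≈SCM w w' same))
    where
    asWords : (Σ (List ℕ) λ u → Σ (List ℕ) λ v → All (Letter n bI) u × All (Letter n bJ) v ×
                (∀ r → r < n → actRight n v (actLeft n u (wordMap w)) r ≡ wordMap w' r)) → SameDoubleCoset I J w w'
    asWords (u , v , uI , vJ , matched) =
      toWord u u<n , toWord v v<n , InW-toWord I u uI , InW-toWord J v vJ ,
      ≈M-trans (mat-doubleCoset (toWord u u<n) w (toWord v v<n))
               (≈M-trans (permMatrix-cong onRows) (≈M-sym (mat≈permMatrix n w')))
      where
      u<n : All (_< n) u
      u<n = All.map proj₁ uI
      v<n : All (_< n) v
      v<n = All.map proj₁ vJ
      onRows : ∀ r → r < n → doubleCoset (toWord u u<n) w (toWord v v<n) r ≡ wordMap w' r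
      onRows r r<n rewrite letters-toWord u u<n | letters-toWord v v<n = matched r r<n

-- Realising a signed contingency matrix

module Realisation (n' : ℕ) (I J : Subset (suc n')) (A : SCM (marginOf I) (marginOf J)) where

  open Tally n' I J

  ent : ℕ → ℕ → ℕ × ℕ
  ent = zeroExtend (SCM.entry A)

  ent-outside : ∀ i j → kα ≤ i ⊎ kβ ≤ j → ent i j ≡ (0 , 0)
  ent-outside = zeroExtend-outside (SCM.entry A)

  ent-fromℕ< : ∀ i j (i<kα : i < kα) (j<kβ : j < kβ) → ent i j ≡ SCM.entry A (fromℕ< i<kα) (fromℕ< j<kβ)
  ent-fromℕ< = zeroExtend-fromℕ< (SCM.entry A)

  ∑-ent-row : ∀ i → ∑[ j < kβ ] ∣ ent i j ∣ₛ ≡ ∑[ r < n ] ⟦ rowBlock r == i ⟧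
  ∑-ent-row i = byCase (i <? kα)
    where
    byCase : Dec (i < kα) → ∑[ j < kβ ] ∣ ent i j ∣ₛ ≡ ∑[ r < n ] ⟦ rowBlock r == i ⟧
    byCase (yes i<kα) = trans (sym (sumℕ≡∑< kβ (λ j → ∣ ent i j ∣ₛ)))
      (trans (sumℕ-cong (λ j → cong ∣_∣ₛ (trans (ent-fromℕ< i (toℕ j) i<kα (toℕ<n j))
                                                 (cong (SCM.entry A (fromℕ< i<kα)) (fromℕ<-toℕ j (toℕ<n j))))))
      (trans (SCM.rowSum A (fromℕ< i<kα)) (trans (lookup≡nth (Margin.comp α) (fromℕ< i<kα))
      (trans (cong (nth (Margin.comp α)) (toℕ-fromℕ< i<kα)) (MI.nth-comp i)))))
    byCase (no i≮kα) = trans (∑<-zero kβ (λ j _ → cong ∣_∣ₛ (ent-outside i j (inj₁ (≮⇒≥ i≮kα)))))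
      (sym (∑<-zero n (λ r r<n → cong ⟦_⟧ (==-≢ (λ r∈i → i≮kα (subst (_< kα) r∈i (rowBlock<kα r r<n)))))))

  ∑-ent-col : ∀ j → ∑[ i < kα ] ∣ ent i j ∣ₛ ≡ ∑[ r < n ] ⟦ colBlock r == j ⟧
  ∑-ent-col j = byCase (j <? kβ)
    where
    byCase : Dec (j < kβ) → ∑[ i < kα ] ∣ ent i j ∣ₛ ≡ ∑[ r < n ] ⟦ colBlock r == j ⟧
    byCase (yes j<kβ) = trans (sym (sumℕ≡∑< kα (λ i → ∣ ent i j ∣ₛ)))
      (trans (sumℕ-cong (λ i → cong ∣_∣ₛ (trans (ent-fromℕ< (toℕ i) j (toℕ<n i) j<kβ)
                                                 (cong (λ i' → SCM.entry A i' (fromℕ< j<kβ)) (fromℕ<-toℕ i (toℕ<n i))))))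
      (trans (SCM.colSum A (fromℕ< j<kβ)) (trans (lookup≡nth (Margin.comp β) (fromℕ< j<kβ))
      (trans (cong (nth (Margin.comp β)) (toℕ-fromℕ< j<kβ)) (MJ.nth-comp j)))))
    byCase (no j≮kβ) = trans (∑<-zero kα (λ i _ → cong ∣_∣ₛ (ent-outside i j (inj₂ (≮⇒≥ j≮kβ)))))
      (sym (∑<-zero n (λ r r<n → cong ⟦_⟧ (==-≢ (λ r∈j → j≮kβ (subst (_< kβ) r∈j (colBlock<kβ r r<n)))))))

  ent-lastRow : bI n' ≡ true → ∀ j → proj₂ (ent (rowBlock n') j) ≡ 0
  ent-lastRow λI j = byCase (j <? kβ)
    where
    lastI<kα : rowBlock n' < kα
    lastI<kα = subst (rowBlock n' <_) (sym kα≡) ≤-refl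
    byCase : Dec (j < kβ) → proj₂ (ent (rowBlock n') j) ≡ 0
    byCase (yes j<kβ) = trans (cong proj₂ (ent-fromℕ< _ j lastI<kα j<kβ))
      (SCM.lastRow A (trans MI.lam≡bit λI) _ _ (trans (cong suc (toℕ-fromℕ< lastI<kα)) (sym kα≡)))
    byCase (no j≮kβ) = cong proj₂ (ent-outside _ j (inj₂ (≮⇒≥ j≮kβ)))

  ent-lastCol : bJ n' ≡ true → ∀ i → proj₂ (ent i (colBlock n')) ≡ 0
  ent-lastCol λJ i = byCase (i <? kα)
    where
    lastJ<kβ : colBlock n' < kβ
    lastJ<kβ = subst (colBlock n' <_) (sym kβ≡) ≤-refl
    byCase : Dec (i < kα) → proj₂ (ent i (colBlock n')) ≡ 0
    byCase (yes i<kα) = trans (cong proj₂ (ent-fromℕ< i _ i<kα lastJ<kβ))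
      (SCM.lastCol A (trans MJ.lam≡bit λJ) _ _ (trans (cong suc (toℕ-fromℕ< lastJ<kβ)) (sym kβ≡)))
    byCase (no i≮kα) = cong proj₂ (ent-outside i _ (inj₁ (≮⇒≥ i≮kα)))

  ent-hidden : ∀ i j → rowVisible i ∧ colVisible j ≡ false → proj₂ (ent i j) ≡ 0
  ent-hidden i j invisible with rowHidden i in hiddenRow | colHidden j in hiddenCol
  ... | true  | _    = let (λI , i≡last) = hidden⇒last bI hiddenRow in
                       subst (λ a → proj₂ (ent a j) ≡ 0) (sym i≡last) (ent-lastRow λI j)
  ... | false | true = let (λJ , j≡last) = hidden⇒last bJ hiddenCol in
                       subst (λ c → proj₂ (ent i c) ≡ 0) (sym j≡last) (ent-lastCol λJ i)

  -- Row r, the (rank i r)-th row of its block i, gets the corresponding entry of the layout of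
  -- row i of A.
  rank : ℕ → ℕ → ℕ
  rank i r = ∑[ r' < r ] ⟦ rowBlock r' == i ⟧

  rowColour : ℕ → ℕ × Bool
  rowColour r = layout kβ (ent (rowBlock r)) (rank (rowBlock r) r)

  ⟦rowColour≟⟧ : ∀ i j s r → ⟦ ⌊ (rowBlock r , rowColour r) ≟K (i , j , s) ⌋ ⟧ ≡
    ⟦ rowBlock r == i ⟧ * ⟦ ⌊ layout kβ (ent i) (rank i r) ≟ᶜ (j , s) ⌋ ⟧
  ⟦rowColour≟⟧ i j s r rewrite ⟦ℕ×-≟⟧ _≟ᶜ_ (rowBlock r) (rowColour r) i (j , s) with rowBlock r ≟ i
  ... | yes refl = refl
  ... | no _     = refl

  tallyBy-rowColour : ∀ i j s → tallyBy rowColour (i , j , s) ≡ part s (ent i j)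
  tallyBy-rowColour i j s = begin
    ∑[ r < n ] ⟦ ⌊ (rowBlock r , rowColour r) ≟K (i , j , s) ⌋ ⟧
      ≡⟨ ∑<-cong n (λ r _ → ⟦rowColour≟⟧ i j s r) ⟩
    ∑[ r < n ] (⟦ rowBlock r == i ⟧ * inLayout (rank i r))
      ≡⟨ ∑<-rank n (λ r → rowBlock r == i) inLayout ⟩
    ∑< (∑[ r < n ] ⟦ rowBlock r == i ⟧) inLayout
      ≡⟨ cong (λ m → ∑< m inLayout) (sym (∑-ent-row i)) ⟩
    ∑< (∑[ j < kβ ] ∣ ent i j ∣ₛ) inLayout
      ≡⟨ count-layout kβ (ent i) (λ j kβ≤j → ent-outside i j (inj₂ kβ≤j)) j s ⟩
    part s (ent i j) ∎
    where
    open ≡-Reasoning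
    inLayout : ℕ → ℕ
    inLayout t = ⟦ ⌊ layout kβ (ent i) t ≟ᶜ (j , s) ⌋ ⟧

  ∑-rowColour-col : ∀ j → ∑[ r < n ] ⟦ proj₁ (rowColour r) == j ⟧ ≡ ∑[ r < n ] ⟦ colBlock r == j ⟧
  ∑-rowColour-col j = trans (sym (tallyBy-colSum rowColour j))
    (trans (∑<-cong kα (λ i _ → cong₂ _+_ (tallyBy-rowColour i j false) (tallyBy-rowColour i j true))) (∑-ent-col j))

  -- A negative sign is only laid out where A has a negative entry, hence where signs are visible.
  rowColour-visible : ∀ r → r < n → proj₂ (rowColour r) ≡ true →
    rowVisible (rowBlock r) ∧ colVisible (proj₁ (rowColour r)) ≡ true
  rowColour-visible r r<n negative with rowVisible (rowBlock r) ∧ colVisible (proj₁ (rowColour r)) in visible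
  ... | true  = refl
  ... | false = ⊥-elim (1+n≢0 (trans (sym selfCount) (∑<-zero⇒ n _ noNegative r r<n)))
    where
    i j : ℕ
    i = rowBlock r
    j = proj₁ (rowColour r)
    noNegative : tallyBy rowColour (i , j , true) ≡ 0
    noNegative = trans (tallyBy-rowColour i j true) (ent-hidden i j visible)
    selfCount : ⟦ ⌊ (i , rowColour r) ≟K (i , j , true) ⌋ ⟧ ≡ 1
    selfCount rewrite sym negative with (i , rowColour r) ≟K (i , rowColour r)
    ... | yes _  = refl
    ... | no ≢  = ⊥-elim (≢ refl)

  private
    oneBlock : ℕ → Bool
    oneBlock _ = true

    block-oneBlock : ∀ r → block oneBlock r ≡ 0
    block-oneBlock r = ∑<-zero r (λ _ _ → refl)

  open Sorting _≟_ n oneBlock using (InBlockSwap; SortsTo) renaming (sortWithinBlocks to sortAll)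

  inOneBlock : ∀ (y : ℕ → ℕ) a j →
    count (ℕ×-≟ _≟_) n (λ r → block oneBlock r , y r) (a , j) ≡ ⟦ 0 == a ⟧ * ∑[ r < n ] ⟦ y r == j ⟧
  inOneBlock y a j = trans (∑<-cong n (λ r _ → trans (⟦ℕ×-≟⟧ _≟_ (block oneBlock r) (y r) a j)
                             (cong (λ b → ⟦ b == a ⟧ * ⟦ y r == j ⟧) (block-oneBlock r))))
                           (∑<-distribˡ-* n ⟦ 0 == a ⟧ (λ r → ⟦ y r == j ⟧))

  sortedColumns : SortsTo n colBlock (proj₁ ∘ rowColour)
  sortedColumns = sortAll n ≤-refl colBlock (proj₁ ∘ rowColour) λ (a , j) →
    trans (inOneBlock colBlock a j) (trans (cong (⟦ 0 == a ⟧ *_) (sym (∑-rowColour-col j)))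
                                           (sym (inOneBlock (proj₁ ∘ rowColour) a j)))

  Realising : Set
  Realising = Σ (List ℕ) λ W → All (_< n) W × (∀ r → r < n → colourOf (signed n W) r ≡ rowColour r)

  realising : Realising
  realising = withSigns sortedColumns
    where
    withSigns : SortsTo n colBlock (proj₁ ∘ rowColour) → Realising
    withSigns (u , swaps , sorted) =
      prependFlips (flipSigns n' oneBlock (proj₂ ∘ rowColour)
                      (λ r _ _ → refl , trans (block-oneBlock r) (sym (block-oneBlock n'))) (signed n u) n ≤-refl)
      where
      visibleSign-rowColour : ∀ r → r < n →
        visibleSign (rowBlock r) (perm n u r , proj₂ (rowColour r)) ≡ proj₂ (rowColour r)
      visibleSign-rowColour r r<n rewrite sorted r r<n with proj₂ (rowColour r) in negative
      ... | false = refl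
      ... | true  = rowColour-visible r r<n negative
      prependFlips : (Σ (List ℕ) λ f → All (Letter n oneBlock) f ×
                       (∀ x → actLeft n f (signed n u) x ≡ flipIf (flipBelow n (proj₂ ∘ rowColour) x) (signed n u x))) →
                     Realising
      prependFlips (f , letters , flipped) = f ++ u , ++⁺ (All.map proj₁ letters) (All.map (<-trans (n<1+n _) ∘ proj₁) swaps) ,
        λ r r<n → begin
          colourOf (signed n (f ++ u)) r
            ≡⟨ cong (λ F → colourOf F r) (actLeft-++ n f u idSigned) ⟩
          colourOf (actLeft n f (signed n u)) r
            ≡⟨ cong (λ e → colBlock (proj₁ e) , visibleSign (rowBlock r) e) (realised r r<n) ⟩
          colBlock (perm n u r) , visibleSign (rowBlock r) (perm n u r , proj₂ (rowColour r))
            ≡⟨ cong₂ _,_ (sorted r r<n) (visibleSign-rowColour r r<n) ⟩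
          rowColour r ∎
        where
        open ≡-Reasoning
        realised : ∀ r → r < n → actLeft n f (signed n u) r ≡ (perm n u r , proj₂ (rowColour r))
        realised r r<n rewrite flipped r | flipBelow-< (proj₂ ∘ rowColour) n r r<n
                             | actLeft-swaps n u idSigned r (All.map proj₁ swaps) =
          cong (perm n u r ,_) (Bool.xor-identityʳ _)

  toSCM-realising : ∀ W (W<n : All (_< n) W) → (∀ r → r < n → colourOf (signed n W) r ≡ rowColour r) →
    toSCM (toWord W W<n) ≈SCM A
  toSCM-realising W W<n realised i j = begin
    tally (wordMap w) (toℕ i , toℕ j , false) , tally (wordMap w) (toℕ i , toℕ j , true)
      ≡⟨ cong₂ _,_ (tallyRealised (toℕ i , toℕ j , false)) (tallyRealised (toℕ i , toℕ j , true)) ⟩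
    tallyBy rowColour (toℕ i , toℕ j , false) , tallyBy rowColour (toℕ i , toℕ j , true)
      ≡⟨ cong₂ _,_ (tallyBy-rowColour (toℕ i) (toℕ j) false) (tallyBy-rowColour (toℕ i) (toℕ j) true) ⟩
    ent (toℕ i) (toℕ j)
      ≡⟨ zeroExtend-toℕ (SCM.entry A) i j ⟩
    SCM.entry A i j ∎
    where
    open ≡-Reasoning
    w : Word n
    w = toWord W W<n
    tallyRealised : ∀ x → tally (wordMap w) x ≡ tallyBy rowColour x
    tallyRealised x rewrite letters-toWord W W<n =
      ∑<-cong n (λ r r<n → cong (λ c → ⟦ ⌊ (rowBlock r , c) ≟K x ⌋ ⟧) (realised r r<n))

toSCM-surjective : ∀ n' (I J : Subset (suc n')) (A : SCM (marginOf I) (marginOf J)) →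
  Σ (Word (suc n')) λ w → Tally.toSCM n' I J w ≈SCM A
toSCM-surjective n' I J A = let (W , W<n , realised) = realising in toWord W W<n , toSCM-realising W W<n realised
  where open Realisation n' I J A

proposition3p1p8 : (n : ℕ) → 2 ≤ n → (I J : Subset n) →
    Σ (Word n → SCM (marginOf I) (marginOf J)) λ f →
      ((w w' : Word n) →
        (f w ≈SCM f w' → SameDoubleCoset I J w w') ×
        (SameDoubleCoset I J w w' → f w ≈SCM f w')) ×
      ((A : SCM (marginOf I) (marginOf J)) → Σ (Word n) λ w → f w ≈SCM A)
proposition3p1p8 (suc n') _ I J =
  toSCM , (λ w w' → toSCM-injective w w' , toSCM-respects-doubleCoset w w') , toSCM-surjective n' I J
  where open Tally n' I J
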